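{- Let $k\ge1$ and let $\lambda=(\lambda_1,\dots,\lambda_k)$ be a weakly decreasing sequence of nonnegative integers. Then $$F_\lambda(q)=\sum_{i=1}^k\ \sum_{1=t_1<t_2<\dots<t_i\le k} M(t_1,\dots,t_i:k)\,[i+1]^{\lambda_{t_i}}\prod_{j=2}^{i}[j]^{\lambda_{t_{j-1}}-\lambda_{t_j}+1},$$ where $$M(t_1,\dots,t_i:k)=(-1)^{k+i}q^{ -ik+\sum_{j=1}^i t_j}\,[i]^{k-t_i}\prod_{j=1}^{i-1}[j]^{t_{j+1}-t_j-1}.$$
   Context: For an integer $m\ge0$, $[m]=1+q+\dots+q^{m-1}$; the convention $0^0=1$ is not needed here. For a weakly decreasing sequence $\lambda=(\lambda_1,\dots,\lambda_k)$ of nonnegative integers, $Y_\lambda$ is the left-justified Young diagram with $\lambda_i$ boxes in row $i$ (rows top to bottom). A Le-filling of $Y_\lambda$ is a map $D:Y_\lambda\to\{0,1\}$ such that no box filled with $0$ has a box filled with $1$ above it in the same column and a box filled with $1$ to its left in the same row. $F_\lambda(q)=\sum_D q^{\#\{\text{boxes filled with }1\}}$, summed over all Le-fillings $D$ of $Y_\lambda$. -}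

module Defs where

open import Data.Bool using (Bool; true; false; _∧_; _∨_; not; if_then_else_)
open import Data.Nat as ℕ using (ℕ; zero; suc; _∸_)
open import Data.List using (List; []; _∷_; map; concatMap; filter; length; upTo; foldr)
open import Data.Bool.ListAction using (all; any)
open import Data.Maybe using (Maybe; just; nothing; fromMaybe)
open import Data.Rational as ℚ using (ℚ; 0ℚ; 1ℚ; _+_; _*_; -_; 1/_; ≢-nonZero)
open import Relation.Binary.PropositionalEquality using (_≢_)

nth : {A : Set} → A → List A → ℕ → A
nth d []       _       = d
nth d (x ∷ xs) zero    = x
nth d (x ∷ xs) (suc n) = nth d xs n

Σℚ : List ℚ → ℚ
Σℚ = foldr _+_ 0ℚ

Πℚ : List ℚ → ℚ
Πℚ = foldr _*_ 1ℚ

infixr 8 _^_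
_^_ : ℚ → ℕ → ℚ
x ^ zero  = 1ℚ
x ^ suc n = x * (x ^ n)

-- [a..b] inclusive list of naturals (empty if b < a)
range : ℕ → ℕ → List ℕ
range a b = map (a ℕ.+_) (upTo (suc b ∸ a))

[_]q : ℕ → ℚ → ℚ
[ m ]q q = Σℚ (map (q ^_) (upTo m))

-- Young diagrams and Le-fillings
-- λ is a list of row lengths (row i, 0-indexed, has λ_i boxes).
-- A filling of Y_λ is a list of rows, row i being a list of λ_i Booleans
-- (true = 1, false = 0); box (i , j) = row i, column j (0-indexed).

boolLists : ℕ → List (List Bool)
boolLists zero    = [] ∷ []
boolLists (suc n) = concatMap (λ r → (false ∷ r) ∷ (true ∷ r) ∷ []) (boolLists n)

fillings : List ℕ → List (List (List Bool))
fillings []       = [] ∷ []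
fillings (l ∷ ls) = concatMap (λ r → map (r ∷_) (fillings ls)) (boolLists l)

-- entry of box (i , j); boxes outside the diagram read as 0
entry : List (List Bool) → ℕ → ℕ → Bool
entry D i j = nth false (nth [] D i) j

-- D is a Le-filling: no box (i,j) filled with 0 has a 1 above it in
-- column j (some i' < i) and a 1 to its left in row i (some j' < j)
isLe : List (List Bool) → Bool
isLe D = all (λ i → all (λ j →
           entry D i j ∨
           not (any (λ i' → entry D i' j) (upTo i) ∧ any (λ j' → entry D i j') (upTo j)))
         (upTo (length (nth [] D i)))) (upTo (length D))

ones : List (List Bool) → ℕ
ones D = foldr (λ r n → foldr (λ b m → if b then suc m else m) n r) 0 D

F : List ℕ → ℚ → ℚ
F λs q = Σℚ (map (λ D → q ^ ones D) (filter (λ D → isLe D Data.Bool.≟ true) (fillings λs)))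
  where import Data.Bool

sublists : List ℕ → List (List ℕ)
sublists []       = [] ∷ []
sublists (x ∷ xs) = concatMap (λ s → (x ∷ s) ∷ s ∷ []) (sublists xs)

-- all sequences 1 = t_1 < t_2 < ... < t_i ≤ k (stored as lists, 1-indexed values)
tSeqs : ℕ → List (List ℕ)
tSeqs k = map (1 ∷_) (sublists (range 2 k))

-- λ_t for 1-indexed t
lam : List ℕ → ℕ → ℕ
lam λs t = nth 0 λs (t ∸ 1)

-- t_j for 1-indexed j
tt : List ℕ → ℕ → ℕ
tt ts j = nth 0 ts (j ∸ 1)

sumℕ : List ℕ → ℕ
sumℕ = foldr ℕ._+_ 0

-- M(t_1,...,t_i : k), with q^{-ik+Σt_j} = (1/q)^{ik - Σt_j}  (note Σ t_j ≤ ik)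
M : (q : ℚ) → q ≢ 0ℚ → List ℕ → ℕ → ℚ
M q q≢0 ts k =
  let i = length ts in
  ((- 1ℚ) ^ (k ℕ.+ i))
  * ((1/_ q {{≢-nonZero q≢0}}) ^ (i ℕ.* k ∸ sumℕ ts))
  * ([ i ]q q ^ (k ∸ tt ts i))
  * Πℚ (map (λ j → [ j ]q q ^ (tt ts (suc j) ∸ tt ts j ∸ 1)) (range 1 (i ∸ 1)))

term : List ℕ → (q : ℚ) → q ≢ 0ℚ → List ℕ → ℚ
term λs q q≢0 ts =
  let k = length λs ; i = length ts in
  M q q≢0 ts k
  * ([ suc i ]q q ^ lam λs (tt ts i))
  * Πℚ (map (λ j → [ j ]q q ^ (lam λs (tt ts (j ∸ 1)) ∸ lam λs (tt ts j) ℕ.+ 1)) (range 2 i))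

RHS : List ℕ → (q : ℚ) → q ≢ 0ℚ → ℚ
RHS λs q q≢0 =
  let k = length λs in
  Σℚ (map (λ i → Σℚ (map (term λs q q≢0)
                          (filter (λ ts → length ts ℕ.≟ i) (tSeqs k))))
          (range 1 k))

-- Build a Le-filling by adding rows on top.  A 1 may be placed above a box of the
-- filling D below exactly when its column is not blocked, i.e. holds no 0 with a 1
-- to its left.  Weight D additionally by x for each unblocked column among the first
-- λ₁ columns; this gives F_λ(q; x) with F_λ(q) = F_λ(q; 1).  Summing over the top
-- rows of length l column by column gives, with d = l − λ₁,
--   ((1 + qx) − x) F_(l,λ)(q; x) = (1 − x) x^d F_λ(q; x) + qx (1 + qx)^d F_λ(q; 1 + qx).
-- At x = [m+1] one has 1 + qx = [m+2] and (1 + qx) − x = q^(m+1), so a row either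
-- keeps the level m, with factor ν_m [m+1]^d where ν_m = −[m] q^(−m), or raises it,
-- with factor μ_m [m+2]^d where μ_m = [m+1] q^(−m).  Unfolding this over all rows
-- writes F_λ(q) = F_λ(q; [1]) as a sum over the rows t₁ < … < tᵢ where the level rises;
-- ν₀ = 0 forces t₁ = 1, and the factors collected along such a path multiply out to
-- the summand of the theorem.

module Submission where

open import Algebra.Bundles using (CommutativeMonoid; CommutativeRing)
import Algebra.Properties.CommutativeSemigroup as CommSemigroupₚ
import Algebra.Properties.CommutativeSemiring.Exp as SemiringExp
open import Data.Bool as Bool using (Bool; true; false; T; _∧_; _∨_; not; if_then_else_)
open import Data.Bool.ListAction using (all; any; and; or)
import Data.Bool.Properties as Boolₚ
open import Data.Empty using (⊥-elim)
open import Data.List as List using (List; []; _∷_; map; concatMap; filter; upTo; length; foldr; _++_)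
import Data.List.Properties as Listₚ
open import Data.List.Relation.Unary.All as All using (All; []; _∷_)
import Data.List.Relation.Unary.All.Properties as Allₚ
import Data.List.Relation.Unary.Any.Properties as Anyₚ
open import Data.List.Relation.Unary.Linked as Linked using (Linked; []; [-]; _∷_)
open import Data.Nat as ℕ using (ℕ; zero; suc; _∸_; _≤_; _<_; _≥_; _<ᵇ_; z≤n; s≤s)
import Data.Nat.Properties as ℕₚ
import Data.Nat.Solver as ℕ-Solver
open import Data.Product using (_×_; _,_; proj₁; proj₂; ∃)
open import Data.Rational as ℚ using (ℚ; 0ℚ; 1ℚ; _+_; _*_; -_; _-_; 1/_; ≢-nonZero)
import Data.Rational.Properties as ℚₚ
import Data.Rational.Solver as ℚ-Solver
open import Data.Sum using (_⊎_; inj₁; inj₂)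
open import Function using (_∘_; id; Equivalence)
open import Relation.Binary.PropositionalEquality
open import Relation.Nullary using (¬_; does)
open import Relation.Nullary.Decidable using (dec-true; dec-false)
open import Relation.Unary using (Decidable)

open import Defs

open CommSemigroupₚ (CommutativeMonoid.commutativeSemigroup ℚₚ.+-0-commutativeMonoid) using ()
  renaming (interchange to +-interchange)
open CommSemigroupₚ (CommutativeMonoid.commutativeSemigroup ℚₚ.*-1-commutativeMonoid) using ()
  renaming (interchange to *-interchange)
open CommSemigroupₚ ℕₚ.+-commutativeSemigroup using (x∙yz≈y∙xz)
module Exp = SemiringExp (CommutativeRing.commutativeSemiring ℚₚ.+-*-commutativeRing)

private
  variable
    A B : Set

Σℚ-++ : (f : A → ℚ) (xs ys : List A) → Σℚ (map f (xs ++ ys)) ≡ Σℚ (map f xs) + Σℚ (map f ys)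
Σℚ-++ f []       ys = sym (ℚₚ.+-identityˡ _)
Σℚ-++ f (x ∷ xs) ys = trans (cong (f x +_) (Σℚ-++ f xs ys)) (sym (ℚₚ.+-assoc (f x) _ _))

Σℚ-map-+ : (f g : A → ℚ) (xs : List A) → Σℚ (map (λ x → f x + g x) xs) ≡ Σℚ (map f xs) + Σℚ (map g xs)
Σℚ-map-+ f g []       = refl
Σℚ-map-+ f g (x ∷ xs) = trans (cong (f x + g x +_) (Σℚ-map-+ f g xs)) (+-interchange (f x) (g x) _ _)

Σℚ-map-*ˡ : (c : ℚ) (f : A → ℚ) (xs : List A) → Σℚ (map (λ x → c * f x) xs) ≡ c * Σℚ (map f xs)
Σℚ-map-*ˡ c f []       = sym (ℚₚ.*-zeroʳ c)
Σℚ-map-*ˡ c f (x ∷ xs) = trans (cong (c * f x +_) (Σℚ-map-*ˡ c f xs)) (sym (ℚₚ.*-distribˡ-+ c _ _))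

Σℚ-map-0 : (xs : List A) → Σℚ (map (λ _ → 0ℚ) xs) ≡ 0ℚ
Σℚ-map-0 []       = refl
Σℚ-map-0 (x ∷ xs) = trans (ℚₚ.+-identityˡ _) (Σℚ-map-0 xs)

Σℚ-filter : {P : A → Set} (P? : Decidable P) (f : A → ℚ) (xs : List A) →
  Σℚ (map f (filter P? xs)) ≡ Σℚ (map (λ x → if does (P? x) then f x else 0ℚ) xs)
Σℚ-filter P? f []       = refl
Σℚ-filter P? f (x ∷ xs) with does (P? x)
... | true  = cong (f x +_) (Σℚ-filter P? f xs)
... | false = trans (Σℚ-filter P? f xs) (sym (ℚₚ.+-identityˡ _))

Σℚ-concatMap : (f : B → ℚ) (g : A → List B) (xs : List A) →
  Σℚ (map f (concatMap g xs)) ≡ Σℚ (map (λ x → Σℚ (map f (g x))) xs)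
Σℚ-concatMap f g []       = refl
Σℚ-concatMap f g (x ∷ xs) =
  trans (Σℚ-++ f (g x) (concatMap g xs)) (cong (Σℚ (map f (g x)) +_) (Σℚ-concatMap f g xs))

Σℚ-pairs : (f : B → ℚ) (g h : A → B) (xs : List A) →
  Σℚ (map f (concatMap (λ x → g x ∷ h x ∷ []) xs)) ≡ Σℚ (map (λ x → f (g x) + f (h x)) xs)
Σℚ-pairs f g h []       = refl
Σℚ-pairs f g h (x ∷ xs) =
  trans (sym (ℚₚ.+-assoc (f (g x)) (f (h x)) _)) (cong (f (g x) + f (h x) +_) (Σℚ-pairs f g h xs))

Σℚ-swap : (f : A → B → ℚ) (xs : List A) (ys : List B) →
  Σℚ (map (λ x → Σℚ (map (f x) ys)) xs) ≡ Σℚ (map (λ y → Σℚ (map (λ x → f x y) xs)) ys)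
Σℚ-swap f []       ys = sym (Σℚ-map-0 ys)
Σℚ-swap f (x ∷ xs) ys = trans (cong (Σℚ (map (f x) ys) +_) (Σℚ-swap f xs ys))
                              (sym (Σℚ-map-+ (f x) (λ y → Σℚ (map (λ x → f x y) xs)) ys))

Πℚ-map-* : (f g : A → ℚ) (xs : List A) → Πℚ (map (λ x → f x * g x) xs) ≡ Πℚ (map f xs) * Πℚ (map g xs)
Πℚ-map-* f g []       = refl
Πℚ-map-* f g (x ∷ xs) = trans (cong (f x * g x *_) (Πℚ-map-* f g xs)) (*-interchange (f x) (g x) _ _)

upTo-suc : ∀ n → upTo (suc n) ≡ 0 ∷ map suc (upTo n)
upTo-suc n = cong (0 ∷_) (sym (Listₚ.map-applyUpTo id suc n))

Πℚ-upTo-suc : (c : ℕ → ℚ) (n : ℕ) → Πℚ (map c (upTo (suc n))) ≡ c 0 * Πℚ (map (c ∘ suc) (upTo n))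
Πℚ-upTo-suc c n = trans (cong (λ js → Πℚ (map c js)) (upTo-suc n))
                        (cong (λ ps → c 0 * Πℚ ps) (sym (Listₚ.map-∘ (upTo n))))

Πℚ-upTo-rotate : (c : ℕ → ℚ) (n : ℕ) → Πℚ (map c (upTo n)) * c n ≡ c 0 * Πℚ (map (c ∘ suc) (upTo n))
Πℚ-upTo-rotate c zero    = ℚₚ.*-comm 1ℚ (c 0)
Πℚ-upTo-rotate c (suc n) = begin
  Πℚ (map c (upTo (suc n))) * c (suc n)              ≡⟨ cong (_* c (suc n)) (Πℚ-upTo-suc c n) ⟩
  c 0 * Πℚ (map (c ∘ suc) (upTo n)) * c (suc n)      ≡⟨ ℚₚ.*-assoc (c 0) _ _ ⟩
  c 0 * (Πℚ (map (c ∘ suc) (upTo n)) * c (suc n))    ≡⟨ cong (c 0 *_) (Πℚ-upTo-rotate (c ∘ suc) n) ⟩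
  c 0 * (c 1 * Πℚ (map (c ∘ suc ∘ suc) (upTo n)))    ≡⟨ cong (c 0 *_) (sym (Πℚ-upTo-suc (c ∘ suc) n)) ⟩
  c 0 * Πℚ (map (c ∘ suc) (upTo (suc n)))            ∎
  where open ≡-Reasoning

^≡Exp^ : ∀ x n → x ^ n ≡ x Exp.^ n
^≡Exp^ x zero    = refl
^≡Exp^ x (suc n) = cong (x *_) (^≡Exp^ x n)

^-+ : ∀ x m n → x ^ (m ℕ.+ n) ≡ x ^ m * x ^ n
^-+ x m n = trans (^≡Exp^ x (m ℕ.+ n))
  (trans (Exp.^-homo-* x m n) (sym (cong₂ _*_ (^≡Exp^ x m) (^≡Exp^ x n))))

^-* : ∀ x m n → (x ^ m) ^ n ≡ x ^ (m ℕ.* n)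
^-* x m n = trans (trans (^≡Exp^ (x ^ m) n) (cong (Exp._^ n) (^≡Exp^ x m)))
  (trans (Exp.^-assocʳ x m n) (sym (^≡Exp^ x (m ℕ.* n))))

^-distribʳ-* : ∀ x y n → (x * y) ^ n ≡ x ^ n * y ^ n
^-distribʳ-* x y n = trans (^≡Exp^ (x * y) n)
  (trans (Exp.^-distrib-* x y n) (sym (cong₂ _*_ (^≡Exp^ x n) (^≡Exp^ y n))))

1^n≡1 : ∀ n → 1ℚ ^ n ≡ 1ℚ
1^n≡1 zero    = refl
1^n≡1 (suc n) = cong (1ℚ *_) (1^n≡1 n)

[-1]^[n+n]≡1 : ∀ n → (- 1ℚ) ^ (n ℕ.+ n) ≡ 1ℚ
[-1]^[n+n]≡1 zero    = refl
[-1]^[n+n]≡1 (suc n) rewrite ℕₚ.+-suc n n | [-1]^[n+n]≡1 n = refl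

all-upTo-suc : ∀ (p : ℕ → Bool) n → all p (upTo (suc n)) ≡ p 0 ∧ all (p ∘ suc) (upTo n)
all-upTo-suc p n = cong (λ bs → p 0 ∧ and bs)
  (trans (Listₚ.map-applyUpTo suc p n) (sym (Listₚ.map-applyUpTo id (p ∘ suc) n)))

any-upTo-suc : ∀ (p : ℕ → Bool) n → any p (upTo (suc n)) ≡ p 0 ∨ any (p ∘ suc) (upTo n)
any-upTo-suc p n = cong (λ bs → p 0 ∨ or bs)
  (trans (Listₚ.map-applyUpTo suc p n) (sym (Listₚ.map-applyUpTo id (p ∘ suc) n)))

all-∧ : (p p′ : A → Bool) (xs : List A) → all (λ x → p x ∧ p′ x) xs ≡ all p xs ∧ all p′ xs
all-∧ p p′ []       = refl
all-∧ p p′ (x ∷ xs) with p x | p′ x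
... | true  | true  = all-∧ p p′ xs
... | true  | false = sym (Boolₚ.∧-zeroʳ (all p xs))
... | false | _     = refl

all-true : {p : A → Bool} → (∀ x → p x ≡ true) → ∀ xs → all p xs ≡ true
all-true e []       = refl
all-true e (x ∷ xs) rewrite e x = all-true e xs

T-all-upTo⁻ : ∀ (p : ℕ → Bool) n → T (all p (upTo n)) → ∀ {j} → j < n → T (p j)
T-all-upTo⁻ p n h = Allₚ.applyUpTo⁻ id n (Allₚ.all⁺ p (upTo n) h)

T-all-upTo⁺ : ∀ (p : ℕ → Bool) n → (∀ {j} → j < n → T (p j)) → T (all p (upTo n))
T-all-upTo⁺ p n h = Allₚ.all⁻ p (Allₚ.applyUpTo⁺₁ id n h)

T-any-upTo⁻ : ∀ (p : ℕ → Bool) n → T (any p (upTo n)) → ∃ λ j → j < n × T (p j)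
T-any-upTo⁻ p n h = Anyₚ.applyUpTo⁻ id (Anyₚ.any⁻ p (upTo n) h)

T-any-upTo⁺ : ∀ (p : ℕ → Bool) {n j} → j < n → T (p j) → T (any p (upTo n))
T-any-upTo⁺ p j<n pj = Anyₚ.any⁺ p (Anyₚ.applyUpTo⁺ id pj j<n)

T-not⁺ : ∀ {b} → ¬ T b → T (not b)
T-not⁺ {false} _  = _
T-not⁺ {true}  ¬b = ¬b _

T-not⁻ : ∀ {b} → T (not b) → ¬ T b
T-not⁻ {false} _ ()

T-extensional : ∀ {a b} → (T a → T b) → (T b → T a) → a ≡ b
T-extensional {false} {false} _ _ = refl
T-extensional {false} {true}  _ g = ⊥-elim (g _)
T-extensional {true}  {false} f _ = ⊥-elim (f _)
T-extensional {true}  {true}  _ _ = refl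

n≤m⇒m<ᵇn≡false : ∀ {m n} → n ≤ m → (m <ᵇ n) ≡ false
n≤m⇒m<ᵇn≡false {n = zero} _         = refl
n≤m⇒m<ᵇn≡false            (s≤s n≤m) = n≤m⇒m<ᵇn≡false n≤m

-- Blocked columns and the Le-condition

oneLeftOf : List Bool → ℕ → Bool
oneLeftOf r j = any (nth false r) (upTo j)

-- Box j of r holds a 0 with a 1 to its left; s records a 1 before the start of r.
blockedRow : Bool → List Bool → ℕ → Bool
blockedRow s r j = (j <ᵇ length r) ∧ not (nth false r j) ∧ (s ∨ oneLeftOf r j)

-- A 1 placed above column j of D breaks the Le-condition exactly when blocked D j.
blocked : List (List Bool) → ℕ → Bool
blocked D j = any (λ i → blockedRow false (nth [] D i) j) (upTo (length D))

avoids : (ℕ → Bool) → List Bool → Bool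
avoids b []      = true
avoids b (c ∷ r) = not (c ∧ b 0) ∧ avoids (b ∘ suc) r

free : (ℕ → Bool) → ℕ → ℕ
free b zero    = 0
free b (suc l) = (if b 0 then 0 else 1) ℕ.+ free (b ∘ suc) l

onesRow : List Bool → ℕ
onesRow = foldr (λ c n → if c then suc n else n) 0

compatible : List Bool → List (List Bool) → Bool
compatible r D = all (λ i → all (λ j → entry D i j ∨ not (nth false r j ∧ oneLeftOf (nth [] D i) j))
                                 (upTo (length (nth [] D i))))
                     (upTo (length D))

ones-∷ : ∀ r D → ones (r ∷ D) ≡ onesRow r ℕ.+ ones D
ones-∷ r D = go r
  where
  go : ∀ r → foldr (λ c n → if c then suc n else n) (ones D) r ≡ onesRow r ℕ.+ ones D
  go []          = refl
  go (true  ∷ r) = cong suc (go r)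
  go (false ∷ r) = go r

blocked-∷ : ∀ r D j → blocked (r ∷ D) j ≡ blockedRow false r j ∨ blocked D j
blocked-∷ r D j = any-upTo-suc (λ i → blockedRow false (nth [] (r ∷ D) i) j) (length D)

blockedRow-∷ : ∀ s c r j → blockedRow s (c ∷ r) (suc j) ≡ blockedRow (s ∨ c) r j
blockedRow-∷ s c r j = cong (λ z → (j <ᵇ length r) ∧ not (nth false r j) ∧ z)
  (trans (cong (s ∨_) (any-upTo-suc (nth false (c ∷ r)) j)) (sym (Boolₚ.∨-assoc s c (oneLeftOf r j))))

blocked-beyond : ∀ {w} D → All (λ row → length row ≤ w) D → ∀ {j} → w ≤ j → blocked D j ≡ false
blocked-beyond []      []              w≤j = refl
blocked-beyond (r ∷ D) (r≤w ∷ D≤w) {j} w≤j = begin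
  blocked (r ∷ D) j                    ≡⟨ blocked-∷ r D j ⟩
  blockedRow false r j ∨ blocked D j   ≡⟨ cong₂ (λ a b → a ∧ not (nth false r j) ∧ oneLeftOf r j ∨ b)
                                                (n≤m⇒m<ᵇn≡false (ℕₚ.≤-trans r≤w w≤j))
                                                (blocked-beyond D D≤w w≤j) ⟩
  false                                ∎
  where open ≡-Reasoning

free-cong : ∀ {b b′} → (∀ j → b j ≡ b′ j) → ∀ l → free b l ≡ free b′ l
free-cong e zero    = refl
free-cong e (suc l) = cong₂ (λ c n → (if c then 0 else 1) ℕ.+ n) (e 0) (free-cong (e ∘ suc) l)

free-unblocked : ∀ b l → (∀ j → b j ≡ false) → free b l ≡ l
free-unblocked b zero    _ = refl
free-unblocked b (suc l) h rewrite h 0 = cong suc (free-unblocked (b ∘ suc) l (h ∘ suc))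

free-beyond : ∀ b {w l} → (∀ {j} → w ≤ j → b j ≡ false) → w ≤ l → free b l ≡ (l ∸ w) ℕ.+ free b w
free-beyond b {zero}  {l}     h _         = trans (free-unblocked b l (λ j → h z≤n)) (sym (ℕₚ.+-identityʳ l))
free-beyond b {suc w} {suc l} h (s≤s w≤l) = begin
  c ℕ.+ free (b ∘ suc) l                 ≡⟨ cong (c ℕ.+_) (free-beyond (b ∘ suc) (h ∘ s≤s) w≤l) ⟩
  c ℕ.+ ((l ∸ w) ℕ.+ free (b ∘ suc) w)   ≡⟨ x∙yz≈y∙xz c (l ∸ w) _ ⟩
  (l ∸ w) ℕ.+ (c ℕ.+ free (b ∘ suc) w)   ∎
  where
  open ≡-Reasoning
  c = if b 0 then 0 else 1

∨-not-∨-∧ : ∀ e p s t → e ∨ not ((p ∨ s) ∧ t) ≡ (e ∨ not (s ∧ t)) ∧ (e ∨ not (p ∧ t))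
∨-not-∨-∧ true  p     s     t = refl
∨-not-∨-∧ false true  true  t = sym (Boolₚ.∧-idem (not t))
∨-not-∨-∧ false true  false t = refl
∨-not-∨-∧ false false s     t = sym (Boolₚ.∧-identityʳ (not (s ∧ t)))

isLe-∷-compatible : ∀ r D → isLe (r ∷ D) ≡ isLe D ∧ compatible r D
isLe-∷-compatible r D = begin
  isLe (r ∷ D)                              ≡⟨ all-upTo-suc Φ (length D) ⟩
  Φ 0 ∧ all (Φ ∘ suc) (upTo (length D))     ≡⟨ cong (_∧ all (Φ ∘ suc) (upTo (length D)))
                                                    (all-true (Boolₚ.∨-zeroʳ ∘ nth false r) (upTo (length r))) ⟩
  all (Φ ∘ suc) (upTo (length D))           ≡⟨ cong and (Listₚ.map-cong below (upTo (length D))) ⟩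
  all (λ i → X i ∧ Y i) (upTo (length D))   ≡⟨ all-∧ X Y (upTo (length D)) ⟩
  isLe D ∧ compatible r D                   ∎
  where
  open ≡-Reasoning
  E = r ∷ D
  Φ X Y : ℕ → Bool
  Φ i = all (λ j → entry E i j ∨ not (any (λ i′ → entry E i′ j) (upTo i) ∧ oneLeftOf (nth [] E i) j))
            (upTo (length (nth [] E i)))
  X i = all (λ j → entry D i j ∨ not (any (λ i′ → entry D i′ j) (upTo i) ∧ oneLeftOf (nth [] D i) j))
            (upTo (length (nth [] D i)))
  Y i = all (λ j → entry D i j ∨ not (nth false r j ∧ oneLeftOf (nth [] D i) j)) (upTo (length (nth [] D i)))
  below : ∀ i → Φ (suc i) ≡ X i ∧ Y i
  below i = trans
    (cong and (Listₚ.map-cong (λ j → trans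
      (cong (λ z → entry D i j ∨ not (z ∧ oneLeftOf (nth [] D i) j)) (any-upTo-suc (λ i′ → entry E i′ j) i))
      (∨-not-∨-∧ (entry D i j) (nth false r j) _ _)) (upTo (length (nth [] D i)))))
    (all-∧ _ _ (upTo (length (nth [] D i))))

T-avoids⁻ : ∀ b r → T (avoids b r) → ∀ {j} → T (nth false r j) → T (not (b j))
T-avoids⁻ b (true ∷ r) h {zero}  _  = proj₁ (Equivalence.to Boolₚ.T-∧ h)
T-avoids⁻ b (c    ∷ r) h {suc j} rj =
  T-avoids⁻ (b ∘ suc) r (proj₂ (Equivalence.to (Boolₚ.T-∧ {not (c ∧ b 0)}) h)) rj

T-avoids⁺ : ∀ b r → (∀ {j} → T (nth false r j) → T (not (b j))) → T (avoids b r)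
T-avoids⁺ b []          h = _
T-avoids⁺ b (false ∷ r) h = T-avoids⁺ (b ∘ suc) r h
T-avoids⁺ b (true  ∷ r) h = Equivalence.from Boolₚ.T-∧ (h {0} _ , T-avoids⁺ (b ∘ suc) r h)

T-blockedRow⁺ : ∀ r {j} → j < length r → ¬ T (nth false r j) → T (oneLeftOf r j) → T (blockedRow false r j)
T-blockedRow⁺ r j<r ¬rj left =
  Equivalence.from Boolₚ.T-∧ (ℕₚ.<⇒<ᵇ j<r , Equivalence.from Boolₚ.T-∧ (T-not⁺ ¬rj , left))

T-blockedRow⁻ : ∀ r {j} → T (blockedRow false r j) → j < length r × ¬ T (nth false r j) × T (oneLeftOf r j)
T-blockedRow⁻ r {j} h =
  let j<r , rest = Equivalence.to Boolₚ.T-∧ h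
      ¬rj , left = Equivalence.to Boolₚ.T-∧ rest
  in ℕₚ.<ᵇ⇒< j (length r) j<r , T-not⁻ ¬rj , left

T-∨-not⁻ : ∀ e c a → T (e ∨ not (c ∧ a)) → T c → T a → T e
T-∨-not⁻ true  c    a    _  _ _ = _
T-∨-not⁻ false true true () _ _

T-∨-not⁺ : ∀ e c a → (T c → T a → ¬ ¬ T e) → T (e ∨ not (c ∧ a))
T-∨-not⁺ true  c     a     _ = _
T-∨-not⁺ false false a     _ = _
T-∨-not⁺ false true  false _ = _
T-∨-not⁺ false true  true  h = h _ _ (λ ())

compatible≡avoids : ∀ r D → compatible r D ≡ avoids (blocked D) r
compatible≡avoids r D = T-extensional to from
  where
  blockedIn : ℕ → ℕ → Bool
  blockedIn j i = blockedRow false (nth [] D i) j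
  to : T (compatible r D) → T (avoids (blocked D) r)
  to h = T-avoids⁺ (blocked D) r λ {j} rj → T-not⁺ λ bj →
    let i , i<D , bij        = T-any-upTo⁻ (blockedIn j) (length D) bj
        j<Di , ¬Dij , leftij = T-blockedRow⁻ (nth [] D i) bij
    in ¬Dij (T-∨-not⁻ (entry D i j) (nth false r j) _ (T-all-upTo⁻ _ _ (T-all-upTo⁻ _ _ h i<D) j<Di) rj leftij)
  from : T (avoids (blocked D) r) → T (compatible r D)
  from h = T-all-upTo⁺ _ (length D) λ {i} i<D → T-all-upTo⁺ _ (length (nth [] D i)) λ {j} j<Di →
    T-∨-not⁺ (entry D i j) (nth false r j) _ λ rj leftij ¬Dij →
      T-not⁻ (T-avoids⁻ (blocked D) r h rj)
             (T-any-upTo⁺ (blockedIn j) {length D} i<D (T-blockedRow⁺ (nth [] D i) j<Di ¬Dij leftij))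

isLe-∷ : ∀ r D → isLe (r ∷ D) ≡ isLe D ∧ avoids (blocked D) r
isLe-∷ r D = trans (isLe-∷-compatible r D) (cong (isLe D ∧_) (compatible≡avoids r D))

-- Adding a top row

module RowTransfer (q x : ℚ) where

  open ℚ-Solver.+-*-Solver using (solve; _:=_; con; _:+_; _:*_; _:-_)

  y : ℚ
  y = 1ℚ + q * x

  rowWeight : Bool → (ℕ → Bool) → List Bool → ℚ
  rowWeight s b r =
    if avoids b r then q ^ onesRow r * x ^ free (λ j → b j ∨ blockedRow s r j) (length r) else 0ℚ

  -- Weight of a column with entry c; a 0 keeps its column free only while s says no 1 occurred yet.
  columnFactor : Bool → Bool → Bool → ℚ
  columnFactor s blk true  = if blk then 0ℚ else q * x
  columnFactor s blk false = if blk ∨ s then 1ℚ else x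

  first-column : ∀ s blk c A o f →
    (if not (c ∧ blk) ∧ A
       then q ^ (if c then suc o else o) * x ^ ((if blk ∨ (not c ∧ s) then 0 else 1) ℕ.+ f) else 0ℚ)
    ≡ columnFactor s blk c * (if A then q ^ o * x ^ f else 0ℚ)
  first-column s true  true  A     o f = sym (ℚₚ.*-zeroˡ (if A then q ^ o * x ^ f else 0ℚ))
  first-column s false true  false o f = sym (ℚₚ.*-zeroʳ (q * x))
  first-column s false true  true  o f =
    solve 4 (λ q x Q X → q :* Q :* (x :* X) := q :* x :* (Q :* X)) refl q x (q ^ o) (x ^ f)
  first-column s blk   false A     o f with blk ∨ s | A
  ... | true  | true  = sym (ℚₚ.*-identityˡ _)
  ... | true  | false = sym (ℚₚ.*-zeroʳ 1ℚ)
  ... | false | true  = solve 3 (λ x Q X → Q :* (x :* X) := x :* (Q :* X)) refl x (q ^ o) (x ^ f)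
  ... | false | false = sym (ℚₚ.*-zeroʳ x)

  rowWeight-∷ : ∀ s b c r → rowWeight s b (c ∷ r) ≡ columnFactor s (b 0) c * rowWeight (s ∨ c) (b ∘ suc) r
  rowWeight-∷ s b c r = trans
    (cong (λ n → if avoids b (c ∷ r) then q ^ onesRow (c ∷ r) * x ^ n else 0ℚ) free-∷)
    (first-column s (b 0) c (avoids (b ∘ suc) r) (onesRow r) _)
    where
    free-∷ : free (λ j → b j ∨ blockedRow s (c ∷ r) j) (suc (length r))
           ≡ (if b 0 ∨ (not c ∧ s) then 0 else 1) ℕ.+ free (λ j → b (suc j) ∨ blockedRow (s ∨ c) r j) (length r)
    free-∷ = cong₂ (λ u n → (if b 0 ∨ not c ∧ u then 0 else 1) ℕ.+ n) (Boolₚ.∨-identityʳ s)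
                   (free-cong (λ j → cong (b (suc j) ∨_) (blockedRow-∷ s c r j)) (length r))

  rowSum : Bool → (ℕ → Bool) → ℕ → ℚ
  rowSum s b l = Σℚ (map (rowWeight s b) (boolLists l))

  rowSum-suc : ∀ s b l → rowSum s b (suc l)
    ≡ columnFactor s (b 0) false * rowSum s (b ∘ suc) l + columnFactor s (b 0) true * rowSum true (b ∘ suc) l
  rowSum-suc s b l = begin
    rowSum s b (suc l)
      ≡⟨ Σℚ-pairs (rowWeight s b) (false ∷_) (true ∷_) (boolLists l) ⟩
    Σℚ (map (λ r → rowWeight s b (false ∷ r) + rowWeight s b (true ∷ r)) (boolLists l))
      ≡⟨ cong Σℚ (Listₚ.map-cong (λ r → cong₂ _+_ (split false (Boolₚ.∨-identityʳ s) r)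
                                                  (split true (Boolₚ.∨-zeroʳ s) r)) (boolLists l)) ⟩
    Σℚ (map (λ r → c₀ * R₀ r + c₁ * R₁ r) (boolLists l))
      ≡⟨ Σℚ-map-+ (λ r → c₀ * R₀ r) (λ r → c₁ * R₁ r) (boolLists l) ⟩
    Σℚ (map (λ r → c₀ * R₀ r) (boolLists l)) + Σℚ (map (λ r → c₁ * R₁ r) (boolLists l))
      ≡⟨ cong₂ _+_ (Σℚ-map-*ˡ c₀ R₀ (boolLists l)) (Σℚ-map-*ˡ c₁ R₁ (boolLists l)) ⟩
    c₀ * rowSum s (b ∘ suc) l + c₁ * rowSum true (b ∘ suc) l
      ∎
    where
    open ≡-Reasoning
    c₀ = columnFactor s (b 0) false
    c₁ = columnFactor s (b 0) true
    R₀ = rowWeight s (b ∘ suc)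
    R₁ = rowWeight true (b ∘ suc)
    split : ∀ c {s′} → s ∨ c ≡ s′ → ∀ r →
            rowWeight s b (c ∷ r) ≡ columnFactor s (b 0) c * rowWeight s′ (b ∘ suc) r
    split c refl r = rowWeight-∷ s b c r

  rowSum-after-one : ∀ b l → rowSum true b l ≡ y ^ free b l
  rowSum-after-one b zero    = refl
  rowSum-after-one b (suc l) = begin
    rowSum true b (suc l)                                          ≡⟨ rowSum-suc true b l ⟩
    c₀ * rowSum true (b ∘ suc) l + c₁ * rowSum true (b ∘ suc) l    ≡⟨ cong (λ R → c₀ * R + c₁ * R)
                                                                           (rowSum-after-one (b ∘ suc) l) ⟩
    c₀ * y ^ f + c₁ * y ^ f                                        ≡⟨ sym (ℚₚ.*-distribʳ-+ (y ^ f) c₀ c₁) ⟩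
    (c₀ + c₁) * y ^ f                                              ≡⟨ cong (_* y ^ f) (factors (b 0)) ⟩
    y ^ (if b 0 then 0 else 1) * y ^ f                             ≡⟨ sym (^-+ y (if b 0 then 0 else 1) f) ⟩
    y ^ free b (suc l)                                             ∎
    where
    open ≡-Reasoning
    f = free (b ∘ suc) l
    c₀ = columnFactor true (b 0) false
    c₁ = columnFactor true (b 0) true
    factors : ∀ blk → columnFactor true blk false + columnFactor true blk true ≡ y ^ (if blk then 0 else 1)
    factors true  = refl
    factors false = sym (ℚₚ.*-identityʳ y)

  rowSum-before-one : ∀ b l → (y - x) * rowSum false b l ≡ (1ℚ - x) * x ^ free b l + q * x * y ^ free b l
  rowSum-before-one b zero    =
    solve 2 (λ q x → (con 1ℚ :+ q :* x :- x) :* con 1ℚ := (con 1ℚ :- x) :* con 1ℚ :+ q :* x :* con 1ℚ) refl q x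
  rowSum-before-one b (suc l) = begin
    (y - x) * rowSum false b (suc l)
      ≡⟨ cong ((y - x) *_) (rowSum-suc false b l) ⟩
    (y - x) * (columnFactor false (b 0) false * R + columnFactor false (b 0) true * rowSum true (b ∘ suc) l)
      ≡⟨ cong (λ R′ → (y - x) * (columnFactor false (b 0) false * R + columnFactor false (b 0) true * R′))
              (rowSum-after-one (b ∘ suc) l) ⟩
    (y - x) * (columnFactor false (b 0) false * R + columnFactor false (b 0) true * y ^ f)
      ≡⟨ step (b 0) (rowSum-before-one (b ∘ suc) l) ⟩
    (1ℚ - x) * x ^ free b (suc l) + q * x * y ^ free b (suc l)
      ∎
    where
    open ≡-Reasoning
    f = free (b ∘ suc) l
    R = rowSum false (b ∘ suc) l
    step : ∀ blk → (y - x) * R ≡ (1ℚ - x) * x ^ f + q * x * y ^ f →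
           (y - x) * (columnFactor false blk false * R + columnFactor false blk true * y ^ f)
           ≡ (1ℚ - x) * x ^ ((if blk then 0 else 1) ℕ.+ f) + q * x * y ^ ((if blk then 0 else 1) ℕ.+ f)
    step true  ih = trans (cong ((y - x) *_) (solve 2 (λ R Y → con 1ℚ :* R :+ con 0ℚ :* Y := R) refl R (y ^ f))) ih
    step false ih = begin
      (y - x) * (x * R + q * x * y ^ f)
        ≡⟨ solve 5 (λ y x q R Y → (y :- x) :* (x :* R :+ q :* x :* Y)
                                 := x :* ((y :- x) :* R) :+ (y :- x) :* q :* x :* Y) refl y x q R (y ^ f) ⟩
      x * ((y - x) * R) + (y - x) * q * x * y ^ f
        ≡⟨ cong (λ z → x * z + (y - x) * q * x * y ^ f) ih ⟩
      x * ((1ℚ - x) * x ^ f + q * x * y ^ f) + (y - x) * q * x * y ^ f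
        ≡⟨ solve 4 (λ q x X Y → x :* ((con 1ℚ :- x) :* X :+ q :* x :* Y)
                                 :+ ((con 1ℚ :+ q :* x) :- x) :* q :* x :* Y
                               := (con 1ℚ :- x) :* (x :* X) :+ q :* x :* ((con 1ℚ :+ q :* x) :* Y))
                   refl q x (x ^ f) (y ^ f) ⟩
      (1ℚ - x) * x ^ suc f + q * x * y ^ suc f
        ∎

-- The free-column generating function

boolLists-length : ∀ l → All (λ r → length r ≡ l) (boolLists l)
boolLists-length zero    = refl ∷ []
boolLists-length (suc l) =
  Allₚ.concat⁺ (Allₚ.map⁺ (All.map (λ e → cong suc e ∷ cong suc e ∷ []) (boolLists-length l)))

second-≤-first : ∀ {l ls} → Linked _≥_ (l ∷ ls) → nth 0 ls 0 ≤ l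
second-≤-first [-]      = z≤n
second-≤-first (l≥ ∷ _) = l≥

fillings-width : ∀ λs → Linked _≥_ λs → All (All (λ row → length row ≤ nth 0 λs 0)) (fillings λs)
fillings-width []       _  = [] ∷ []
fillings-width (l ∷ ls) lk = Allₚ.concat⁺ (Allₚ.map⁺ (All.map (λ r≡l → Allₚ.map⁺
  (All.map (λ D≤ → ℕₚ.≤-reflexive r≡l ∷ All.map (λ le → ℕₚ.≤-trans le (second-≤-first lk)) D≤)
           (fillings-width ls (Linked.tail lk))))
  (boolLists-length l)))

module _ (q : ℚ) where

  open ℚ-Solver.+-*-Solver using (solve; _:=_; con; _:+_; _:*_)
  open RowTransfer q using (rowWeight; rowSum; rowSum-before-one)

  leWeight : List (List Bool) → ℚ
  leWeight D = if isLe D then q ^ ones D else 0ℚ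

  weight : ℚ → ℕ → List (List Bool) → ℚ
  weight x w D = if isLe D then q ^ ones D * x ^ free (blocked D) w else 0ℚ

  -- F_λ(q; x): besides q per 1, a Le-filling gets a factor x per unblocked column among the first λ₁.
  Fx : ℚ → List ℕ → ℚ
  Fx x λs = Σℚ (map (weight x (nth 0 λs 0)) (fillings λs))

  F≡Fx1 : ∀ λs → F λs q ≡ Fx 1ℚ λs
  F≡Fx1 λs = trans (Σℚ-filter (λ D → isLe D Bool.≟ true) (λ D → q ^ ones D) (fillings λs))
                   (cong Σℚ (Listₚ.map-cong summand (fillings λs)))
    where
    summand : ∀ D → (if does (isLe D Bool.≟ true) then q ^ ones D else 0ℚ) ≡ weight 1ℚ (nth 0 λs 0) D
    summand D with isLe D
    ... | true  = sym (trans (cong (q ^ ones D *_) (1^n≡1 (free (blocked D) (nth 0 λs 0)))) (ℚₚ.*-identityʳ _))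
    ... | false = refl

  weight-∷ : ∀ x r D → weight x (length r) (r ∷ D) ≡ leWeight D * rowWeight x false (blocked D) r
  weight-∷ x r D rewrite isLe-∷ r D | ones-∷ r D
    | free-cong (λ j → trans (blocked-∷ r D j) (Boolₚ.∨-comm (blockedRow false r j) (blocked D j))) (length r)
    = product (isLe D) (avoids (blocked D) r)
    where
    f = free (λ j → blocked D j ∨ blockedRow false r j) (length r)
    product : ∀ a b → (if a ∧ b then q ^ (onesRow r ℕ.+ ones D) * x ^ f else 0ℚ)
                      ≡ (if a then q ^ ones D else 0ℚ) * (if b then q ^ onesRow r * x ^ f else 0ℚ)
    product true  true  = trans (cong (_* x ^ f) (^-+ q (onesRow r) (ones D)))
      (solve 3 (λ R D X → R :* D :* X := D :* (R :* X)) refl (q ^ onesRow r) (q ^ ones D) (x ^ f))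
    product true  false = sym (ℚₚ.*-zeroʳ (q ^ ones D))
    product false b     = sym (ℚₚ.*-zeroˡ (if b then q ^ onesRow r * x ^ f else 0ℚ))

  top-rows-sum : ∀ x l D →
    Σℚ (map (λ r → weight x l (r ∷ D)) (boolLists l)) ≡ leWeight D * rowSum x false (blocked D) l
  top-rows-sum x l D = trans
    (cong Σℚ (Listₚ.map-cong-local (All.map (λ {r} r≡l → trans (cong (λ n → weight x n (r ∷ D)) (sym r≡l))
                                                                (weight-∷ x r D))
                                             (boolLists-length l))))
    (Σℚ-map-*ˡ (leWeight D) (rowWeight x false (blocked D)) (boolLists l))

  top-rows-recurrence : ∀ x {l w} D → w ≤ l → All (λ row → length row ≤ w) D →
    ((1ℚ + q * x) - x) * Σℚ (map (λ r → weight x l (r ∷ D)) (boolLists l))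
    ≡ (1ℚ - x) * x ^ (l ∸ w) * weight x w D + q * x * (1ℚ + q * x) ^ (l ∸ w) * weight (1ℚ + q * x) w D
  top-rows-recurrence x {l} {w} D w≤l D≤w = begin
    (y - x) * Σℚ (map (λ r → weight x l (r ∷ D)) (boolLists l))
      ≡⟨ cong ((y - x) *_) (top-rows-sum x l D) ⟩
    (y - x) * (leWeight D * rowSum x false b l)
      ≡⟨ solve 3 (λ a W R → a :* (W :* R) := W :* (a :* R)) refl (y - x) (leWeight D) (rowSum x false b l) ⟩
    leWeight D * ((y - x) * rowSum x false b l)
      ≡⟨ cong (leWeight D *_) (rowSum-before-one x b l) ⟩
    leWeight D * ((1ℚ - x) * x ^ free b l + q * x * y ^ free b l)
      ≡⟨ cong (λ n → leWeight D * ((1ℚ - x) * x ^ n + q * x * y ^ n)) (free-beyond b (blocked-beyond D D≤w) w≤l) ⟩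
    leWeight D * ((1ℚ - x) * x ^ (d ℕ.+ f) + q * x * y ^ (d ℕ.+ f))
      ≡⟨ cong₂ (λ X Y → leWeight D * ((1ℚ - x) * X + q * x * Y)) (^-+ x d f) (^-+ y d f) ⟩
    leWeight D * ((1ℚ - x) * (x ^ d * x ^ f) + q * x * (y ^ d * y ^ f))
      ≡⟨ distribute (isLe D) ⟩
    (1ℚ - x) * x ^ d * weight x w D + q * x * y ^ d * weight y w D
      ∎
    where
    open ≡-Reasoning
    y = 1ℚ + q * x
    b = blocked D
    d = l ∸ w
    f = free b w
    distribute : ∀ a → (if a then q ^ ones D else 0ℚ) * ((1ℚ - x) * (x ^ d * x ^ f) + q * x * (y ^ d * y ^ f))
                       ≡ (1ℚ - x) * x ^ d * (if a then q ^ ones D * x ^ f else 0ℚ)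
                         + q * x * y ^ d * (if a then q ^ ones D * y ^ f else 0ℚ)
    distribute true  = solve 7 (λ Q u X F v Y G → Q :* (u :* (X :* F) :+ v :* (Y :* G))
                                                 := u :* X :* (Q :* F) :+ v :* Y :* (Q :* G))
                         refl (q ^ ones D) (1ℚ - x) (x ^ d) (x ^ f) (q * x) (y ^ d) (y ^ f)
    distribute false = solve 3 (λ Z u v → con 0ℚ :* Z := u :* con 0ℚ :+ v :* con 0ℚ)
                         refl ((1ℚ - x) * (x ^ d * x ^ f) + q * x * (y ^ d * y ^ f)) ((1ℚ - x) * x ^ d) (q * x * y ^ d)

  Fx-recurrence : ∀ x {l ls} → Linked _≥_ (l ∷ ls) →
    ((1ℚ + q * x) - x) * Fx x (l ∷ ls)
    ≡ (1ℚ - x) * x ^ (l ∸ nth 0 ls 0) * Fx x ls + q * x * (1ℚ + q * x) ^ (l ∸ nth 0 ls 0) * Fx (1ℚ + q * x) ls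
  Fx-recurrence x {l} {ls} lk = begin
    (y - x) * Fx x (l ∷ ls)
      ≡⟨ cong ((y - x) *_) (trans (Σℚ-concatMap (weight x l) (λ r → map (r ∷_) (fillings ls)) (boolLists l))
                                  (cong Σℚ (Listₚ.map-cong (λ r → cong Σℚ (sym (Listₚ.map-∘ (fillings ls))))
                                                           (boolLists l)))) ⟩
    (y - x) * Σℚ (map (λ r → Σℚ (map (λ D → weight x l (r ∷ D)) (fillings ls))) (boolLists l))
      ≡⟨ cong ((y - x) *_) (Σℚ-swap (λ r D → weight x l (r ∷ D)) (boolLists l) (fillings ls)) ⟩
    (y - x) * Σℚ (map (λ D → Σℚ (map (λ r → weight x l (r ∷ D)) (boolLists l))) (fillings ls))
      ≡⟨ sym (Σℚ-map-*ˡ (y - x) (λ D → Σℚ (map (λ r → weight x l (r ∷ D)) (boolLists l))) (fillings ls)) ⟩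
    Σℚ (map (λ D → (y - x) * Σℚ (map (λ r → weight x l (r ∷ D)) (boolLists l))) (fillings ls))
      ≡⟨ cong Σℚ (Listₚ.map-cong-local (All.map (λ {D} → top-rows-recurrence x D (second-≤-first lk))
                                                 (fillings-width ls (Linked.tail lk)))) ⟩
    Σℚ (map (λ D → cx * weight x w D + cy * weight y w D) (fillings ls))
      ≡⟨ Σℚ-map-+ (λ D → cx * weight x w D) (λ D → cy * weight y w D) (fillings ls) ⟩
    Σℚ (map (λ D → cx * weight x w D) (fillings ls)) + Σℚ (map (λ D → cy * weight y w D) (fillings ls))
      ≡⟨ cong₂ _+_ (Σℚ-map-*ˡ cx (weight x w) (fillings ls)) (Σℚ-map-*ˡ cy (weight y w) (fillings ls)) ⟩
    cx * Fx x ls + cy * Fx y ls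
      ∎
    where
    open ≡-Reasoning
    y = 1ℚ + q * x
    w = nth 0 ls 0
    cx = (1ℚ - x) * x ^ (l ∸ w)
    cy = q * x * y ^ (l ∸ w)

-- q-brackets

module Brackets (q : ℚ) (q≢0 : q ≢ 0ℚ) where

  open ℚ-Solver.+-*-Solver using (solve; _:=_; con; _:+_; _:*_; _:-_; :-_)

  q⁻¹ : ℚ
  q⁻¹ = 1/_ q {{≢-nonZero q≢0}}

  q⁻¹^n*q^n≡1 : ∀ n → q⁻¹ ^ n * q ^ n ≡ 1ℚ
  q⁻¹^n*q^n≡1 n = trans (sym (^-distribʳ-* q⁻¹ q n))
    (trans (cong (_^ n) (ℚₚ.*-inverseˡ q {{≢-nonZero q≢0}})) (1^n≡1 n))

  ⟦_⟧ : ℕ → ℚ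
  ⟦ n ⟧ = [ n ]q q

  ⟦1+n⟧≡1+q⟦n⟧ : ∀ n → ⟦ suc n ⟧ ≡ 1ℚ + q * ⟦ n ⟧
  ⟦1+n⟧≡1+q⟦n⟧ n = cong (1ℚ +_) (trans
    (cong Σℚ (trans (Listₚ.map-applyUpTo suc (q ^_) n) (sym (Listₚ.map-applyUpTo id (λ j → q * q ^ j) n))))
    (Σℚ-map-*ˡ q (q ^_) (upTo n)))

  ⟦1+n⟧≡⟦n⟧+qⁿ : ∀ n → ⟦ suc n ⟧ ≡ ⟦ n ⟧ + q ^ n
  ⟦1+n⟧≡⟦n⟧+qⁿ n = begin
    Σℚ (map (q ^_) (upTo (suc n)))       ≡⟨ cong (λ js → Σℚ (map (q ^_) js)) (sym (Listₚ.upTo-∷ʳ n)) ⟩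
    Σℚ (map (q ^_) (upTo n ++ n ∷ []))   ≡⟨ Σℚ-++ (q ^_) (upTo n) (n ∷ []) ⟩
    ⟦ n ⟧ + (q ^ n + 0ℚ)                 ≡⟨ cong (⟦ n ⟧ +_) (ℚₚ.+-identityʳ (q ^ n)) ⟩
    ⟦ n ⟧ + q ^ n                        ∎
    where open ≡-Reasoning

  ν μ : ℕ → ℚ
  ν m = - (⟦ m ⟧ * q⁻¹ ^ m)
  μ m = ⟦ suc m ⟧ * q⁻¹ ^ m

  -- Fx-recurrence at x = [m+1], where 1 + qx = [m+2] and (1 + qx) − x = q^(m+1).
  Fx-bracket-recurrence : ∀ m {l ls} → Linked _≥_ (l ∷ ls) →
    Fx q ⟦ suc m ⟧ (l ∷ ls) ≡ ν m * ⟦ suc m ⟧ ^ (l ∸ nth 0 ls 0) * Fx q ⟦ suc m ⟧ ls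
                            + μ m * ⟦ suc (suc m) ⟧ ^ (l ∸ nth 0 ls 0) * Fx q ⟦ suc (suc m) ⟧ ls
  Fx-bracket-recurrence m {l} {ls} lk = begin
    P                                        ≡⟨ sym (ℚₚ.*-identityˡ P) ⟩
    1ℚ * P                                   ≡⟨ cong (_* P) (sym (q⁻¹^n*q^n≡1 (suc m))) ⟩
    q⁻¹ ^ suc m * q ^ suc m * P              ≡⟨ cong (λ z → q⁻¹ ^ suc m * z * P) (sym gap) ⟩
    q⁻¹ ^ suc m * (y - x) * P                ≡⟨ ℚₚ.*-assoc (q⁻¹ ^ suc m) (y - x) P ⟩
    q⁻¹ ^ suc m * ((y - x) * P)              ≡⟨ cong (q⁻¹ ^ suc m *_) (Fx-recurrence q x lk) ⟩
    q⁻¹ ^ suc m * ((1ℚ - x) * x ^ d * Fx q x ls + q * x * y ^ d * Fx q y ls)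
      ≡⟨ cong₂ (λ u Y → q⁻¹ ^ suc m * ((1ℚ - u) * x ^ d * Fx q x ls + q * x * Y ^ d * Fx q Y ls))
               (⟦1+n⟧≡1+q⟦n⟧ m) (sym (⟦1+n⟧≡1+q⟦n⟧ (suc m))) ⟩
    q⁻¹ * q⁻¹ ^ m * ((1ℚ - (1ℚ + q * ⟦ m ⟧)) * x ^ d * Fx q x ls + q * x * Y ^ d * Fx q Y ls)
      ≡⟨ solve 9 (λ i I q b x X P Z G →
           i :* I :* ((con 1ℚ :- (con 1ℚ :+ q :* b)) :* X :* P :+ q :* x :* Z :* G)
           := (i :* q) :* ((:- (b :* I)) :* X :* P :+ x :* I :* Z :* G)) refl
           q⁻¹ (q⁻¹ ^ m) q ⟦ m ⟧ x (x ^ d) (Fx q x ls) (Y ^ d) (Fx q Y ls) ⟩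
    q⁻¹ * q * (ν m * x ^ d * Fx q x ls + μ m * Y ^ d * Fx q Y ls)
      ≡⟨ cong (_* (ν m * x ^ d * Fx q x ls + μ m * Y ^ d * Fx q Y ls)) (ℚₚ.*-inverseˡ q {{≢-nonZero q≢0}}) ⟩
    1ℚ * (ν m * x ^ d * Fx q x ls + μ m * Y ^ d * Fx q Y ls)
      ≡⟨ ℚₚ.*-identityˡ _ ⟩
    ν m * x ^ d * Fx q x ls + μ m * Y ^ d * Fx q Y ls
      ∎
    where
    open ≡-Reasoning
    x = ⟦ suc m ⟧
    y = 1ℚ + q * x
    Y = ⟦ suc (suc m) ⟧
    d = l ∸ nth 0 ls 0
    P = Fx q x (l ∷ ls)
    gap : y - x ≡ q ^ suc m
    gap = trans (cong (_- x) (trans (sym (⟦1+n⟧≡1+q⟦n⟧ (suc m))) (⟦1+n⟧≡⟦n⟧+qⁿ (suc m))))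
                (solve 2 (λ x c → x :+ c :- x := c) refl x (q ^ suc m))

-- Intervals and chains of rows

interval : ℕ → ℕ → List ℕ
interval a n = map (a ℕ.+_) (upTo n)

interval-suc : ∀ a n → interval a (suc n) ≡ a ∷ interval (suc a) n
interval-suc a n = trans (cong (map (a ℕ.+_)) (upTo-suc n))
  (cong₂ _∷_ (ℕₚ.+-identityʳ a) (trans (sym (Listₚ.map-∘ (upTo n))) (Listₚ.map-cong (ℕₚ.+-suc a) (upTo n))))

module _ (v : ℚ) (c : ℕ) where

  private
    indicator : ℕ → ℚ
    indicator i = if does (c ℕ.≟ i) then v else 0ℚ

  Σℚ-indicator-∉ : ∀ {a} n → c < a → Σℚ (map indicator (interval a n)) ≡ 0ℚ
  Σℚ-indicator-∉     zero    c<a = refl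
  Σℚ-indicator-∉ {a} (suc n) c<a = begin
    Σℚ (map indicator (interval a (suc n)))                 ≡⟨ cong (Σℚ ∘ map indicator) (interval-suc a n) ⟩
    indicator a + Σℚ (map indicator (interval (suc a) n))   ≡⟨ cong₂ _+_ (cong (λ b → if b then v else 0ℚ)
                                                                                 (dec-false (c ℕ.≟ a) (ℕₚ.<⇒≢ c<a)))
                                                                           (Σℚ-indicator-∉ n (ℕₚ.m<n⇒m<1+n c<a)) ⟩
    0ℚ + 0ℚ                                                 ≡⟨ ℚₚ.+-identityʳ 0ℚ ⟩
    0ℚ                                                      ∎
    where open ≡-Reasoning

  Σℚ-indicator-∈ : ∀ {a} n → a ≤ c → c < a ℕ.+ n → Σℚ (map indicator (interval a n)) ≡ v
  Σℚ-indicator-∈ {a} zero    a≤c c<a+0 = ⊥-elim (ℕₚ.<⇒≱ (subst (c <_) (ℕₚ.+-identityʳ a) c<a+0) a≤c)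
  Σℚ-indicator-∈ {a} (suc n) a≤c c<a+n =
    trans (cong (Σℚ ∘ map indicator) (interval-suc a n)) (head (ℕₚ.m≤n⇒m<n∨m≡n a≤c))
    where
    head : a < c ⊎ a ≡ c → indicator a + Σℚ (map indicator (interval (suc a) n)) ≡ v
    head (inj₁ a<c)  = trans (cong₂ _+_ (cong (λ b → if b then v else 0ℚ) (dec-false (c ℕ.≟ a) (ℕₚ.>⇒≢ a<c)))
                                        (Σℚ-indicator-∈ n a<c (subst (c <_) (ℕₚ.+-suc a n) c<a+n)))
                             (ℚₚ.+-identityˡ v)
    head (inj₂ refl) = trans (cong₂ _+_ (cong (λ b → if b then v else 0ℚ) (dec-true (c ℕ.≟ c) refl))
                                        (Σℚ-indicator-∉ n (ℕₚ.n<1+n c)))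
                             (ℚₚ.+-identityʳ v)

Σℚ-by-length : ∀ k (f : List A → ℚ) xs → All (λ x → 1 ≤ length x × length x ≤ k) xs →
  Σℚ (map (λ i → Σℚ (map f (filter (λ x → length x ℕ.≟ i) xs))) (range 1 k)) ≡ Σℚ (map f xs)
Σℚ-by-length k f xs bounds = begin
  Σℚ (map (λ i → Σℚ (map f (filter (λ x → length x ℕ.≟ i) xs))) (range 1 k))
    ≡⟨ cong Σℚ (Listₚ.map-cong (λ i → Σℚ-filter (λ x → length x ℕ.≟ i) f xs) (range 1 k)) ⟩
  Σℚ (map (λ i → Σℚ (map (λ x → if does (length x ℕ.≟ i) then f x else 0ℚ) xs)) (range 1 k))
    ≡⟨ Σℚ-swap (λ i x → if does (length x ℕ.≟ i) then f x else 0ℚ) (range 1 k) xs ⟩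
  Σℚ (map (λ x → Σℚ (map (λ i → if does (length x ℕ.≟ i) then f x else 0ℚ) (range 1 k))) xs)
    ≡⟨ cong Σℚ (Listₚ.map-cong-local
         (All.map (λ {x} b → Σℚ-indicator-∈ (f x) (length x) k (proj₁ b) (s≤s (proj₂ b))) bounds)) ⟩
  Σℚ (map f xs)
    ∎
  where open ≡-Reasoning

module Chains (k : ℕ) where

  open ℕ-Solver.+-*-Solver using (solve; _:=_; con; _:+_; _:*_)

  Ascending : ℕ → List ℕ → Set
  Ascending r []      = r ≤ k
  Ascending r (t ∷ s) = r < t × Ascending t s

  Ascending-lower : ∀ {p a} s → p < a → Ascending a s → Ascending p s
  Ascending-lower []      p<a a≤k         = ℕₚ.<⇒≤ (ℕₚ.<-≤-trans p<a a≤k)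
  Ascending-lower (t ∷ s) p<a (a<t , asc) = ℕₚ.<-trans p<a a<t , asc

  Ascending-interval : ∀ n {p a} → p < a → a ℕ.+ n ≤ suc k → Ascending p (interval a n)
  Ascending-interval zero    {p} {a} p<a a+0≤ =
    ℕₚ.≤-pred (ℕₚ.≤-trans p<a (ℕₚ.≤-trans (ℕₚ.m≤m+n a 0) a+0≤))
  Ascending-interval (suc n) {p} {a} p<a a+n≤ = subst (Ascending p) (sym (interval-suc a n))
    (p<a , Ascending-interval n (ℕₚ.n<1+n a) (subst (_≤ suc k) (ℕₚ.+-suc a n) a+n≤))

  sublists-Ascending : ∀ {p} xs → Ascending p xs → All (Ascending p) (sublists xs)
  sublists-Ascending []       p≤k         = p≤k ∷ []
  sublists-Ascending (x ∷ xs) (p<x , asc) = Allₚ.concat⁺ (Allₚ.map⁺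
    (All.map (λ {s} as → (p<x , as) ∷ Ascending-lower s p<x as ∷ []) (sublists-Ascending xs asc)))

  Ascending-length : ∀ {t} s → Ascending t s → length s ℕ.+ t ≤ k
  Ascending-length []       t≤k          = t≤k
  Ascending-length (t′ ∷ s) (t<t′ , asc) = ℕₚ.<-≤-trans (ℕₚ.+-monoʳ-< (length s) t<t′) (Ascending-length s asc)

  -- Product over the blocks [t, t′) of the chain t < s₁ < … < sₙ < k + 1; f sees the block number.
  Πchain : (ℕ → ℕ → ℕ → ℚ) → ℕ → ℕ → List ℕ → ℚ
  Πchain f m t []       = f m t (suc k)
  Πchain f m t (t′ ∷ s) = f m t t′ * Πchain f (suc m) t′ s

  Σchain : (ℕ → ℕ → ℕ → ℕ) → ℕ → ℕ → List ℕ → ℕ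
  Σchain e m t []       = e m t (suc k)
  Σchain e m t (t′ ∷ s) = e m t t′ ℕ.+ Σchain e (suc m) t′ s

  Πchain-cong : ∀ {f g} → (∀ m a b → f m a b ≡ g m a b) → ∀ m t s → Πchain f m t s ≡ Πchain g m t s
  Πchain-cong e m t []       = e m t (suc k)
  Πchain-cong e m t (t′ ∷ s) = cong₂ _*_ (e m t t′) (Πchain-cong e (suc m) t′ s)

  Πchain-* : ∀ f g m t s → Πchain (λ m a b → f m a b * g m a b) m t s ≡ Πchain f m t s * Πchain g m t s
  Πchain-* f g m t []       = refl
  Πchain-* f g m t (t′ ∷ s) = trans (cong (f m t t′ * g m t t′ *_) (Πchain-* f g (suc m) t′ s))
                                    (*-interchange (f m t t′) (g m t t′) _ _)

  Πchain-^ : ∀ x e m t s → Πchain (λ m a b → x ^ e m a b) m t s ≡ x ^ Σchain e m t s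
  Πchain-^ x e m t []       = refl
  Πchain-^ x e m t (t′ ∷ s) =
    trans (cong (x ^ e m t t′ *_) (Πchain-^ x e (suc m) t′ s)) (sym (^-+ x (e m t t′) _))

  Πchain-shift : ∀ f m t s → Πchain f (suc m) t s ≡ Πchain (f ∘ suc) m t s
  Πchain-shift f m t []       = refl
  Πchain-shift f m t (t′ ∷ s) = cong (f (suc m) t t′ *_) (Πchain-shift f (suc m) t′ s)

  Πchain-nth : ∀ f t s → Πchain f 0 t s
    ≡ Πℚ (map (λ j → f j (nth 0 (t ∷ s) j) (nth 0 (t ∷ s) (suc j))) (upTo (length s)))
      * f (length s) (nth 0 (t ∷ s) (length s)) (suc k)
  Πchain-nth f t []       = sym (ℚₚ.*-identityˡ _)
  Πchain-nth f t (t′ ∷ s) = begin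
    f 0 t t′ * Πchain f 1 t′ s                          ≡⟨ cong (f 0 t t′ *_) (Πchain-shift f 0 t′ s) ⟩
    f 0 t t′ * Πchain (f ∘ suc) 0 t′ s                  ≡⟨ cong (f 0 t t′ *_) (Πchain-nth (f ∘ suc) t′ s) ⟩
    f 0 t t′ * (Πℚ (map (c ∘ suc) (upTo n)) * last)     ≡⟨ sym (ℚₚ.*-assoc (f 0 t t′) _ last) ⟩
    c 0 * Πℚ (map (c ∘ suc) (upTo n)) * last            ≡⟨ cong (_* last) (sym (Πℚ-upTo-suc c n)) ⟩
    Πℚ (map c (upTo (suc n))) * last                    ∎
    where
    open ≡-Reasoning
    n = length s
    c = λ j → f j (nth 0 (t ∷ t′ ∷ s) j) (nth 0 (t ∷ t′ ∷ s) (suc j))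
    last = f (suc n) (nth 0 (t′ ∷ s) n) (suc k)

  Σchain-gaps : ∀ m t s → Ascending t s → Σchain (λ _ a b → b ∸ suc a) m t s ℕ.+ (length s ℕ.+ t) ≡ k
  Σchain-gaps m t []       t≤k          = ℕₚ.m∸n+n≡m t≤k
  Σchain-gaps m t (t′ ∷ s) (t<t′ , asc) = begin
    g ℕ.+ Σ ℕ.+ (suc n ℕ.+ t)     ≡⟨ solve 4 (λ g Σ n t → g :+ Σ :+ (con 1 :+ n :+ t)
                                                       := Σ :+ (n :+ (g :+ (con 1 :+ t)))) refl g Σ n t ⟩
    Σ ℕ.+ (n ℕ.+ (g ℕ.+ suc t))   ≡⟨ cong (λ t″ → Σ ℕ.+ (n ℕ.+ t″)) (ℕₚ.m∸n+n≡m t<t′) ⟩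
    Σ ℕ.+ (n ℕ.+ t′)              ≡⟨ Σchain-gaps (suc m) t′ s asc ⟩
    k                             ∎
    where
    open ≡-Reasoning
    g = t′ ∸ suc t
    Σ = Σchain (λ _ a b → b ∸ suc a) (suc m) t′ s
    n = length s

  Σchain-levels : ∀ m t s → Ascending t s →
    Σchain (λ m a b → m ℕ.+ suc m ℕ.* (b ∸ suc a)) m t s ℕ.+ sumℕ (t ∷ s) ℕ.+ m ℕ.* t
    ≡ suc (length s) ℕ.* k ℕ.+ m ℕ.* suc k
  Σchain-levels m t []       t≤k          = begin
    m ℕ.+ suc m ℕ.* (k ∸ t) ℕ.+ (t ℕ.+ 0) ℕ.+ m ℕ.* t
      ≡⟨ solve 3 (λ m g t → m :+ (con 1 :+ m) :* g :+ (t :+ con 0) :+ m :* t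
                          := con 1 :* (g :+ t) :+ m :* (con 1 :+ (g :+ t))) refl m (k ∸ t) t ⟩
    1 ℕ.* (k ∸ t ℕ.+ t) ℕ.+ m ℕ.* suc (k ∸ t ℕ.+ t)
      ≡⟨ cong (λ k′ → 1 ℕ.* k′ ℕ.+ m ℕ.* suc k′) (ℕₚ.m∸n+n≡m t≤k) ⟩
    1 ℕ.* k ℕ.+ m ℕ.* suc k
      ∎
    where open ≡-Reasoning
  Σchain-levels m t (t′ ∷ s) (t<t′ , asc) = ℕₚ.suc-injective (begin
    suc (m ℕ.+ suc m ℕ.* g ℕ.+ Σ ℕ.+ (t ℕ.+ S) ℕ.+ m ℕ.* t)
      ≡⟨ solve 5 (λ m g Σ t S → con 1 :+ (m :+ (con 1 :+ m) :* g :+ Σ :+ (t :+ S) :+ m :* t)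
                              := Σ :+ S :+ (con 1 :+ m) :* (g :+ (con 1 :+ t))) refl m g Σ t S ⟩
    Σ ℕ.+ S ℕ.+ suc m ℕ.* (g ℕ.+ suc t)
      ≡⟨ cong (λ t″ → Σ ℕ.+ S ℕ.+ suc m ℕ.* t″) (ℕₚ.m∸n+n≡m t<t′) ⟩
    Σ ℕ.+ S ℕ.+ suc m ℕ.* t′
      ≡⟨ Σchain-levels (suc m) t′ s asc ⟩
    suc n ℕ.* k ℕ.+ suc m ℕ.* suc k
      ≡⟨ solve 3 (λ n m k → (con 1 :+ n) :* k :+ (con 1 :+ m) :* (con 1 :+ k)
                          := con 1 :+ ((con 2 :+ n) :* k :+ m :* (con 1 :+ k))) refl n m k ⟩
    suc (suc (suc n) ℕ.* k ℕ.+ m ℕ.* suc k)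
      ∎)
    where
    open ≡-Reasoning
    g = t′ ∸ suc t
    Σ = Σchain (λ m a b → m ℕ.+ suc m ℕ.* (b ∸ suc a)) (suc m) t′ s
    S = sumℕ (t′ ∷ s)
    n = length s

-- Paths through the levels

module Paths (q : ℚ) (q≢0 : q ≢ 0ℚ) (k : ℕ) (L : ℕ → ℕ) (L-antitone : ∀ {a b} → a ≤ b → L b ≤ L a)
  where

  open ℚ-Solver.+-*-Solver using (solve; _:=_; _:*_)
  open Brackets q q≢0
  open Chains k

  d : ℕ → ℕ
  d r = L r ∸ L (suc r)

  -- path m r s weighs the path that is at level m in row r and rises to the next level exactly
  -- in the rows of s: run collects the rows of a block spent at one level, rise a rising row
  -- followed by the rest of its block.
  run : ℕ → ℕ → ℕ → ℚ
  run m r t = ν m ^ (t ∸ r) * ⟦ suc m ⟧ ^ (L r ∸ L t)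

  rise : ℕ → ℕ → ℕ → ℚ
  rise m t t′ = μ m * ν (suc m) ^ (t′ ∸ suc t) * ⟦ suc (suc m) ⟧ ^ (L t ∸ L t′)

  path : ℕ → ℕ → List ℕ → ℚ
  path m r []      = run m r (suc k)
  path m r (t ∷ s) = run m r t * Πchain rise m t s

  L-split : ∀ {r t} → r < t → L r ∸ L t ≡ d r ℕ.+ (L (suc r) ∸ L t)
  L-split {r} {t} r<t = sym (trans (sym (ℕₚ.+-∸-assoc (d r) (L-antitone r<t)))
                                   (cong (_∸ L t) (ℕₚ.m∸n+n≡m (L-antitone (ℕₚ.n≤1+n r)))))

  peel-row : ∀ c N B {r t} → r < t → c * N * B ^ (L r ∸ L t) ≡ c * B ^ d r * (N * B ^ (L (suc r) ∸ L t))
  peel-row c N B {r} {t} r<t = begin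
    c * N * B ^ (L r ∸ L t)                     ≡⟨ cong (λ e → c * N * B ^ e) (L-split r<t) ⟩
    c * N * B ^ (d r ℕ.+ (L (suc r) ∸ L t))     ≡⟨ cong (c * N *_) (^-+ B (d r) (L (suc r) ∸ L t)) ⟩
    c * N * (B ^ d r * B ^ (L (suc r) ∸ L t))   ≡⟨ solve 4 (λ c N X Y → c :* N :* (X :* Y) := c :* X :* (N :* Y))
                                                           refl c N (B ^ d r) (B ^ (L (suc r) ∸ L t)) ⟩
    c * B ^ d r * (N * B ^ (L (suc r) ∸ L t))   ∎
    where open ≡-Reasoning

  run-empty : ∀ m r → run m r r ≡ 1ℚ
  run-empty m r rewrite ℕₚ.n∸n≡0 r | ℕₚ.n∸n≡0 (L r) = refl

  run-split : ∀ m {r t} → r < t → run m r t ≡ ν m * ⟦ suc m ⟧ ^ d r * run m (suc r) t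
  run-split m {r} {t} r<t = trans (cong (λ e → ν m ^ e * ⟦ suc m ⟧ ^ (L r ∸ L t)) (ℕₚ.+-∸-assoc 1 r<t))
                                  (peel-row (ν m) (ν m ^ (t ∸ suc r)) ⟦ suc m ⟧ r<t)

  rise-split : ∀ m {t t′} → t < t′ → rise m t t′ ≡ μ m * ⟦ suc (suc m) ⟧ ^ d t * run (suc m) (suc t) t′
  rise-split m {t} {t′} = peel-row (μ m) (ν (suc m) ^ (t′ ∸ suc t)) ⟦ suc (suc m) ⟧

  path-stay : ∀ m r s → Ascending r s → path m r s ≡ ν m * ⟦ suc m ⟧ ^ d r * path m (suc r) s
  path-stay m r []      r≤k       = run-split m (s≤s r≤k)
  path-stay m r (t ∷ s) (r<t , _) =
    trans (cong (_* Πchain rise m t s) (run-split m r<t)) (ℚₚ.*-assoc (ν m * ⟦ suc m ⟧ ^ d r) _ _)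

  path-rise : ∀ m r s → Ascending r s → path m r (r ∷ s) ≡ μ m * ⟦ suc (suc m) ⟧ ^ d r * path (suc m) (suc r) s
  path-rise m r s asc = trans (cong (_* Πchain rise m r s) (run-empty m r)) (trans (ℚₚ.*-identityˡ _) (rises s asc))
    where
    rises : ∀ s → Ascending r s → Πchain rise m r s ≡ μ m * ⟦ suc (suc m) ⟧ ^ d r * path (suc m) (suc r) s
    rises []       r≤k        = rise-split m (s≤s r≤k)
    rises (t′ ∷ s) (r<t′ , _) = trans (cong (_* Πchain rise (suc m) t′ s) (rise-split m r<t′))
                                      (ℚₚ.*-assoc (μ m * ⟦ suc (suc m) ⟧ ^ d r) _ _)

  -- ν 0 = 0: no path stays at level 0.
  path-start : ∀ r s → Ascending r s → path 0 r (r ∷ s) + path 0 r s ≡ Πchain rise 0 r s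
  path-start r s asc = begin
    path 0 r (r ∷ s) + path 0 r s
      ≡⟨ cong₂ _+_ (trans (cong (_* Πchain rise 0 r s) (run-empty 0 r)) (ℚₚ.*-identityˡ (Πchain rise 0 r s)))
                   (path-stay 0 r s asc) ⟩
    Πchain rise 0 r s + ν 0 * ⟦ 1 ⟧ ^ d r * path 0 (suc r) s
      ≡⟨ cong (Πchain rise 0 r s +_) (trans (cong (_* path 0 (suc r) s) (ℚₚ.*-zeroˡ (⟦ 1 ⟧ ^ d r)))
                                            (ℚₚ.*-zeroˡ (path 0 (suc r) s))) ⟩
    Πchain rise 0 r s + 0ℚ
      ≡⟨ ℚₚ.+-identityʳ (Πchain rise 0 r s) ⟩
    Πchain rise 0 r s
      ∎
    where open ≡-Reasoning

  Σpath-from-level-0 : ∀ r n → suc r ℕ.+ n ≤ suc k →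
    Σℚ (map (path 0 r) (sublists (interval r (suc n)))) ≡ Σℚ (map (Πchain rise 0 r) (sublists (interval (suc r) n)))
  Σpath-from-level-0 r n r+n≤k = begin
    Σℚ (map (path 0 r) (sublists (interval r (suc n))))
      ≡⟨ cong (λ xs → Σℚ (map (path 0 r) (sublists xs))) (interval-suc r n) ⟩
    Σℚ (map (path 0 r) (sublists (r ∷ interval (suc r) n)))
      ≡⟨ Σℚ-pairs (path 0 r) (r ∷_) id S ⟩
    Σℚ (map (λ s → path 0 r (r ∷ s) + path 0 r s) S)
      ≡⟨ cong Σℚ (Listₚ.map-cong-local (All.map (λ {s} → path-start r s)
                                                 (sublists-Ascending (interval (suc r) n)
                                                   (Ascending-interval n (ℕₚ.n<1+n r) r+n≤k)))) ⟩
    Σℚ (map (Πchain rise 0 r) S)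
      ∎
    where
    open ≡-Reasoning
    S = sublists (interval (suc r) n)

  Σpath-first-row : ∀ m r n → suc r ℕ.+ n ≤ suc k →
    Σℚ (map (path m r) (sublists (interval r (suc n))))
    ≡ ν m * ⟦ suc m ⟧ ^ d r * Σℚ (map (path m (suc r)) (sublists (interval (suc r) n)))
      + μ m * ⟦ suc (suc m) ⟧ ^ d r * Σℚ (map (path (suc m) (suc r)) (sublists (interval (suc r) n)))
  Σpath-first-row m r n r+n≤k = begin
    Σℚ (map (path m r) (sublists (interval r (suc n))))
      ≡⟨ cong (λ xs → Σℚ (map (path m r) (sublists xs))) (interval-suc r n) ⟩
    Σℚ (map (path m r) (sublists (r ∷ interval (suc r) n)))
      ≡⟨ Σℚ-pairs (path m r) (r ∷_) id S ⟩
    Σℚ (map (λ s → path m r (r ∷ s) + path m r s) S)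
      ≡⟨ cong Σℚ (Listₚ.map-cong-local (All.map (λ {s} asc → cong₂ _+_ (path-rise m r s asc) (path-stay m r s asc))
                                                 (sublists-Ascending (interval (suc r) n)
                                                   (Ascending-interval n (ℕₚ.n<1+n r) r+n≤k)))) ⟩
    Σℚ (map (λ s → cᵣ * path (suc m) (suc r) s + cₛ * path m (suc r) s) S)
      ≡⟨ Σℚ-map-+ (λ s → cᵣ * path (suc m) (suc r) s) (λ s → cₛ * path m (suc r) s) S ⟩
    Σℚ (map (λ s → cᵣ * path (suc m) (suc r) s) S) + Σℚ (map (λ s → cₛ * path m (suc r) s) S)
      ≡⟨ cong₂ _+_ (Σℚ-map-*ˡ cᵣ (path (suc m) (suc r)) S) (Σℚ-map-*ˡ cₛ (path m (suc r)) S) ⟩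
    cᵣ * Σℚ (map (path (suc m) (suc r)) S) + cₛ * Σℚ (map (path m (suc r)) S)
      ≡⟨ ℚₚ.+-comm (cᵣ * Σℚ (map (path (suc m) (suc r)) S)) (cₛ * Σℚ (map (path m (suc r)) S)) ⟩
    cₛ * Σℚ (map (path m (suc r)) S) + cᵣ * Σℚ (map (path (suc m) (suc r)) S)
      ∎
    where
    open ≡-Reasoning
    S = sublists (interval (suc r) n)
    cₛ = ν m * ⟦ suc m ⟧ ^ d r
    cᵣ = μ m * ⟦ suc (suc m) ⟧ ^ d r

  -- ls lists the row lengths from row r on, padded by nth with L (suc k) = 0.
  Fx-expansion : ∀ ls r m → Linked _≥_ ls → (∀ i → nth 0 ls i ≡ L (i ℕ.+ r)) → r ℕ.+ length ls ≡ suc k →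
    Fx q ⟦ suc m ⟧ ls ≡ Σℚ (map (path m r) (sublists (interval r (length ls))))
  Fx-expansion []       r m _  _ r+0≡ = sym (trans (ℚₚ.+-identityʳ _)
    (trans (cong (run m r) (sym (trans (sym (ℕₚ.+-identityʳ r)) r+0≡))) (run-empty m r)))
  Fx-expansion (l ∷ ls) r m lk h e = begin
    Fx q ⟦ suc m ⟧ (l ∷ ls)
      ≡⟨ Fx-bracket-recurrence m lk ⟩
    ν m * ⟦ suc m ⟧ ^ (l ∸ nth 0 ls 0) * Fx q ⟦ suc m ⟧ ls
      + μ m * ⟦ suc (suc m) ⟧ ^ (l ∸ nth 0 ls 0) * Fx q ⟦ suc (suc m) ⟧ ls
      ≡⟨ cong₂ (λ δ P → ν m * ⟦ suc m ⟧ ^ δ * P + μ m * ⟦ suc (suc m) ⟧ ^ δ * Fx q ⟦ suc (suc m) ⟧ ls)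
               (cong₂ _∸_ (h 0) (h 1)) (Fx-expansion ls (suc r) m (Linked.tail lk) h′ e′) ⟩
    ν m * ⟦ suc m ⟧ ^ d r * Σℚ (map (path m (suc r)) S) + μ m * ⟦ suc (suc m) ⟧ ^ d r * Fx q ⟦ suc (suc m) ⟧ ls
      ≡⟨ cong (λ P → ν m * ⟦ suc m ⟧ ^ d r * Σℚ (map (path m (suc r)) S) + μ m * ⟦ suc (suc m) ⟧ ^ d r * P)
              (Fx-expansion ls (suc r) (suc m) (Linked.tail lk) h′ e′) ⟩
    ν m * ⟦ suc m ⟧ ^ d r * Σℚ (map (path m (suc r)) S)
      + μ m * ⟦ suc (suc m) ⟧ ^ d r * Σℚ (map (path (suc m) (suc r)) S)
      ≡⟨ sym (Σpath-first-row m r (length ls) (ℕₚ.≤-reflexive e′)) ⟩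
    Σℚ (map (path m r) (sublists (interval r (suc (length ls)))))
      ∎
    where
    open ≡-Reasoning
    S = sublists (interval (suc r) (length ls))
    h′ : ∀ i → nth 0 ls i ≡ L (i ℕ.+ suc r)
    h′ i = trans (h (suc i)) (cong L (sym (ℕₚ.+-suc i r)))
    e′ : suc r ℕ.+ length ls ≡ suc k
    e′ = trans (sym (ℕₚ.+-suc r (length ls))) e

-- Matching the summands of the theorem

nth-antitone : ∀ {xs} → Linked _≥_ xs → ∀ {i j} → i ≤ j → nth 0 xs j ≤ nth 0 xs i
nth-antitone []                     _         = z≤n
nth-antitone [-]        {j = zero}  z≤n       = ℕₚ.≤-refl
nth-antitone [-]        {j = suc j} _         = z≤n
nth-antitone (x≥y ∷ lk) {zero}  {zero}  _     = ℕₚ.≤-refl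
nth-antitone (x≥y ∷ lk) {zero}  {suc j} _     = ℕₚ.≤-trans (nth-antitone lk {0} {j} z≤n) x≥y
nth-antitone (x≥y ∷ lk) {suc i} {suc j} (s≤s i≤j) = nth-antitone lk i≤j

lam-antitone : ∀ {λs} → Linked _≥_ λs → ∀ {a b} → a ≤ b → lam λs b ≤ lam λs a
lam-antitone lk a≤b = nth-antitone lk (ℕₚ.∸-monoˡ-≤ 1 a≤b)

nth-length : ∀ (xs : List ℕ) → nth 0 xs (length xs) ≡ 0
nth-length []       = refl
nth-length (x ∷ xs) = nth-length xs

∸-suc : ∀ a b → a ∸ b ∸ 1 ≡ a ∸ suc b
∸-suc a b = trans (ℕₚ.∸-+-assoc a b 1) (cong (a ∸_) (ℕₚ.+-comm b 1))

module Conversion {λs : List ℕ} (lk : Linked _≥_ λs) (q : ℚ) (q≢0 : q ≢ 0ℚ) where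

  open ℚ-Solver.+-*-Solver using (solve; _:=_; con; _:*_; :-_)
  open Brackets q q≢0

  k : ℕ
  k = length λs

  L : ℕ → ℕ
  L = lam λs

  open Chains k
  open Paths q q≢0 k L (lam-antitone lk)

  gapE levelE : ℕ → ℕ → ℕ → ℕ
  gapE   m a b = b ∸ suc a
  levelE m a b = m ℕ.+ suc m ℕ.* (b ∸ suc a)

  gapF unitF ΛF : ℕ → ℕ → ℕ → ℚ
  gapF  m a b = ⟦ suc m ⟧ ^ (b ∸ suc a)
  unitF m a b = ⟦ suc m ⟧
  ΛF    m a b = ⟦ suc (suc m) ⟧ ^ (L a ∸ L b)

  rise-factors : ∀ m a b →
    rise m a b ≡ (- 1ℚ) ^ gapE m a b * q⁻¹ ^ levelE m a b * gapF m a b * (unitF m a b * ΛF m a b)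
  rise-factors m a b = begin
    ⟦ suc m ⟧ * q⁻¹ ^ m * (- (⟦ suc m ⟧ * q⁻¹ ^ suc m)) ^ g * ΛF m a b
      ≡⟨ cong (λ z → ⟦ suc m ⟧ * q⁻¹ ^ m * z * ΛF m a b) ν-power ⟩
    ⟦ suc m ⟧ * q⁻¹ ^ m * ((- 1ℚ) ^ g * (⟦ suc m ⟧ ^ g * q⁻¹ ^ (suc m ℕ.* g))) * ΛF m a b
      ≡⟨ solve 6 (λ x I S X J B → x :* I :* (S :* (X :* J)) :* B := S :* (I :* J) :* X :* (x :* B)) refl
           ⟦ suc m ⟧ (q⁻¹ ^ m) ((- 1ℚ) ^ g) (⟦ suc m ⟧ ^ g) (q⁻¹ ^ (suc m ℕ.* g)) (ΛF m a b) ⟩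
    (- 1ℚ) ^ g * (q⁻¹ ^ m * q⁻¹ ^ (suc m ℕ.* g)) * gapF m a b * (unitF m a b * ΛF m a b)
      ≡⟨ cong (λ z → (- 1ℚ) ^ g * z * gapF m a b * (unitF m a b * ΛF m a b)) (sym (^-+ q⁻¹ m (suc m ℕ.* g))) ⟩
    (- 1ℚ) ^ g * q⁻¹ ^ levelE m a b * gapF m a b * (unitF m a b * ΛF m a b)
      ∎
    where
    open ≡-Reasoning
    g = gapE m a b
    ν-power : (- (⟦ suc m ⟧ * q⁻¹ ^ suc m)) ^ g ≡ (- 1ℚ) ^ g * (⟦ suc m ⟧ ^ g * q⁻¹ ^ (suc m ℕ.* g))
    ν-power = begin
      (- (⟦ suc m ⟧ * q⁻¹ ^ suc m)) ^ g
        ≡⟨ cong (_^ g) (solve 1 (λ X → :- X := con (- 1ℚ) :* X) refl (⟦ suc m ⟧ * q⁻¹ ^ suc m)) ⟩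
      (- 1ℚ * (⟦ suc m ⟧ * q⁻¹ ^ suc m)) ^ g
        ≡⟨ ^-distribʳ-* (- 1ℚ) _ g ⟩
      (- 1ℚ) ^ g * (⟦ suc m ⟧ * q⁻¹ ^ suc m) ^ g
        ≡⟨ cong ((- 1ℚ) ^ g *_) (trans (^-distribʳ-* ⟦ suc m ⟧ (q⁻¹ ^ suc m) g)
                                       (cong (⟦ suc m ⟧ ^ g *_) (^-* q⁻¹ (suc m) g))) ⟩
      (- 1ℚ) ^ g * (⟦ suc m ⟧ ^ g * q⁻¹ ^ (suc m ℕ.* g))
        ∎

  Πchain-rise-factors : ∀ s → Πchain rise 0 1 s
    ≡ (- 1ℚ) ^ Σchain gapE 0 1 s * q⁻¹ ^ Σchain levelE 0 1 s * Πchain gapF 0 1 s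
      * (Πchain unitF 0 1 s * Πchain ΛF 0 1 s)
  Πchain-rise-factors s = begin
    Πchain rise 0 1 s
      ≡⟨ Πchain-cong rise-factors 0 1 s ⟩
    Πchain (λ m a b → S m a b * Q m a b * gapF m a b * (unitF m a b * ΛF m a b)) 0 1 s
      ≡⟨ Πchain-* (λ m a b → S m a b * Q m a b * gapF m a b) (λ m a b → unitF m a b * ΛF m a b) 0 1 s ⟩
    Πchain (λ m a b → S m a b * Q m a b * gapF m a b) 0 1 s * Πchain (λ m a b → unitF m a b * ΛF m a b) 0 1 s
      ≡⟨ cong₂ _*_ (trans (Πchain-* (λ m a b → S m a b * Q m a b) gapF 0 1 s)
                          (cong (_* Πchain gapF 0 1 s) (Πchain-* S Q 0 1 s)))
                   (Πchain-* unitF ΛF 0 1 s) ⟩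
    Πchain S 0 1 s * Πchain Q 0 1 s * Πchain gapF 0 1 s * (Πchain unitF 0 1 s * Πchain ΛF 0 1 s)
      ≡⟨ cong₂ (λ u v → u * v * Πchain gapF 0 1 s * (Πchain unitF 0 1 s * Πchain ΛF 0 1 s))
               (Πchain-^ (- 1ℚ) gapE 0 1 s) (Πchain-^ q⁻¹ levelE 0 1 s) ⟩
    (- 1ℚ) ^ Σchain gapE 0 1 s * q⁻¹ ^ Σchain levelE 0 1 s * Πchain gapF 0 1 s * (Πchain unitF 0 1 s * Πchain ΛF 0 1 s)
      ∎
    where
    open ≡-Reasoning
    S Q : ℕ → ℕ → ℕ → ℚ
    S m a b = (- 1ℚ) ^ gapE m a b
    Q m a b = q⁻¹ ^ levelE m a b

  module _ (s : List ℕ) where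

    private
      ts = 1 ∷ s
      n  = length s

    sign-factor : Ascending 1 s → (- 1ℚ) ^ (k ℕ.+ suc n) ≡ (- 1ℚ) ^ Σchain gapE 0 1 s
    sign-factor asc = begin
      (- 1ℚ) ^ (k ℕ.+ suc n)                     ≡⟨ cong (λ e → (- 1ℚ) ^ (e ℕ.+ suc n)) (sym gaps) ⟩
      (- 1ℚ) ^ (Σg ℕ.+ suc n ℕ.+ suc n)          ≡⟨ cong ((- 1ℚ) ^_) (ℕₚ.+-assoc Σg (suc n) (suc n)) ⟩
      (- 1ℚ) ^ (Σg ℕ.+ (suc n ℕ.+ suc n))        ≡⟨ ^-+ (- 1ℚ) Σg (suc n ℕ.+ suc n) ⟩
      (- 1ℚ) ^ Σg * (- 1ℚ) ^ (suc n ℕ.+ suc n)   ≡⟨ cong ((- 1ℚ) ^ Σg *_) ([-1]^[n+n]≡1 (suc n)) ⟩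
      (- 1ℚ) ^ Σg * 1ℚ                           ≡⟨ ℚₚ.*-identityʳ _ ⟩
      (- 1ℚ) ^ Σg                                ∎
      where
      open ≡-Reasoning
      Σg = Σchain gapE 0 1 s
      gaps : Σg ℕ.+ suc n ≡ k
      gaps = trans (cong (Σg ℕ.+_) (ℕₚ.+-comm 1 n)) (Σchain-gaps 0 1 s asc)

    level-factor : Ascending 1 s → q⁻¹ ^ (suc n ℕ.* k ∸ sumℕ ts) ≡ q⁻¹ ^ Σchain levelE 0 1 s
    level-factor asc = cong (q⁻¹ ^_)
      (trans (cong (_∸ sumℕ ts) levels) (ℕₚ.m+n∸n≡m (Σchain levelE 0 1 s) (sumℕ ts)))
      where
      levels : suc n ℕ.* k ≡ Σchain levelE 0 1 s ℕ.+ sumℕ ts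
      levels = trans (sym (ℕₚ.+-identityʳ _)) (trans (sym (Σchain-levels 0 1 s asc)) (ℕₚ.+-identityʳ _))

    gap-factor : ⟦ suc n ⟧ ^ (k ∸ tt ts (suc n))
                 * Πℚ (map (λ j → ⟦ j ⟧ ^ (tt ts (suc j) ∸ tt ts j ∸ 1)) (range 1 n))
               ≡ Πchain gapF 0 1 s
    gap-factor = begin
      G₁ * Πℚ (map (λ j → ⟦ j ⟧ ^ (tt ts (suc j) ∸ tt ts j ∸ 1)) (range 1 n))
        ≡⟨ cong (λ js → G₁ * Πℚ js) (sym (Listₚ.map-∘ (upTo n))) ⟩
      G₁ * Πℚ (map (λ j → ⟦ suc j ⟧ ^ (nth 0 ts (suc j) ∸ nth 0 ts j ∸ 1)) (upTo n))
        ≡⟨ cong (λ js → G₁ * Πℚ js)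
                (Listₚ.map-cong (λ j → cong (⟦ suc j ⟧ ^_) (∸-suc (nth 0 ts (suc j)) (nth 0 ts j))) (upTo n)) ⟩
      G₁ * Πℚ (map (λ j → gapF j (nth 0 ts j) (nth 0 ts (suc j))) (upTo n))
        ≡⟨ ℚₚ.*-comm G₁ _ ⟩
      Πℚ (map (λ j → gapF j (nth 0 ts j) (nth 0 ts (suc j))) (upTo n)) * G₁
        ≡⟨ sym (Πchain-nth gapF 1 s) ⟩
      Πchain gapF 0 1 s
        ∎
      where
      open ≡-Reasoning
      G₁ = ⟦ suc n ⟧ ^ (k ∸ tt ts (suc n))

    Λ-factor : ⟦ suc (suc n) ⟧ ^ L (tt ts (suc n))
               * Πℚ (map (λ j → ⟦ j ⟧ ^ (L (tt ts (j ∸ 1)) ∸ L (tt ts j) ℕ.+ 1)) (range 2 (suc n)))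
               ≡ Πchain unitF 0 1 s * Πchain ΛF 0 1 s
    Λ-factor = begin
      Λ₁ * Πℚ (map (λ j → ⟦ j ⟧ ^ (L (tt ts (j ∸ 1)) ∸ L (tt ts j) ℕ.+ 1)) (range 2 (suc n)))
        ≡⟨ cong (λ js → Λ₁ * Πℚ js) (sym (Listₚ.map-∘ (upTo n))) ⟩
      Λ₁ * Πℚ (map (λ j → ⟦ suc (suc j) ⟧ ^ (ΔL j ℕ.+ 1)) (upTo n))
        ≡⟨ cong (λ js → Λ₁ * Πℚ js) (Listₚ.map-cong (λ j → ^-+1 ⟦ suc (suc j) ⟧ (ΔL j)) (upTo n)) ⟩
      Λ₁ * Πℚ (map (λ j → ⟦ suc (suc j) ⟧ ^ ΔL j * ⟦ suc (suc j) ⟧) (upTo n))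
        ≡⟨ cong (Λ₁ *_) (Πℚ-map-* (λ j → ⟦ suc (suc j) ⟧ ^ ΔL j) (λ j → ⟦ suc (suc j) ⟧) (upTo n)) ⟩
      Λ₁ * (Λ₂ * U)
        ≡⟨ solve 3 (λ a b c → a :* (b :* c) := c :* (b :* a)) refl Λ₁ Λ₂ U ⟩
      U * (Λ₂ * Λ₁)
        ≡⟨ cong₂ _*_ (sym units) (sym lengths) ⟩
      Πchain unitF 0 1 s * Πchain ΛF 0 1 s
        ∎
      where
      open ≡-Reasoning
      ΔL : ℕ → ℕ
      ΔL j = L (nth 0 ts j) ∸ L (nth 0 ts (suc j))
      Λ₁ = ⟦ suc (suc n) ⟧ ^ L (tt ts (suc n))
      Λ₂ = Πℚ (map (λ j → ⟦ suc (suc j) ⟧ ^ ΔL j) (upTo n))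
      U  = Πℚ (map (λ j → ⟦ suc (suc j) ⟧) (upTo n))
      ^-+1 : ∀ x e → x ^ (e ℕ.+ 1) ≡ x ^ e * x
      ^-+1 x e = trans (^-+ x e 1) (cong (x ^ e *_) (ℚₚ.*-identityʳ x))
      units : Πchain unitF 0 1 s ≡ U
      units = trans (Πchain-nth unitF 1 s) (trans (Πℚ-upTo-rotate (λ j → ⟦ suc j ⟧) n) (ℚₚ.*-identityˡ U))
      lengths : Πchain ΛF 0 1 s ≡ Λ₂ * Λ₁
      lengths = trans (Πchain-nth ΛF 1 s)
                      (cong (λ z → Λ₂ * ⟦ suc (suc n) ⟧ ^ (L (nth 0 ts n) ∸ z)) (nth-length λs))

    term≡Πchain-rise : Ascending 1 s → term λs q q≢0 ts ≡ Πchain rise 0 1 s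
    term≡Πchain-rise asc = begin
      term λs q q≢0 ts
        ≡⟨ solve 6 (λ S Q G₁ G₂ Λ₁ Λ₂ → S :* Q :* G₁ :* G₂ :* Λ₁ :* Λ₂
                                      := S :* Q :* (G₁ :* G₂) :* (Λ₁ :* Λ₂)) refl S Q G₁ G₂ Λ₁ Λ₂ ⟩
      S * Q * (G₁ * G₂) * (Λ₁ * Λ₂)
        ≡⟨ cong₂ _*_ (cong₂ _*_ (cong₂ _*_ (sign-factor asc) (level-factor asc)) gap-factor) Λ-factor ⟩
      (- 1ℚ) ^ Σchain gapE 0 1 s * q⁻¹ ^ Σchain levelE 0 1 s * Πchain gapF 0 1 s
        * (Πchain unitF 0 1 s * Πchain ΛF 0 1 s)
        ≡⟨ sym (Πchain-rise-factors s) ⟩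
      Πchain rise 0 1 s
        ∎
      where
      open ≡-Reasoning
      S  = (- 1ℚ) ^ (k ℕ.+ suc n)
      Q  = q⁻¹ ^ (suc n ℕ.* k ∸ sumℕ ts)
      G₁ = ⟦ suc n ⟧ ^ (k ∸ tt ts (suc n))
      G₂ = Πℚ (map (λ j → ⟦ j ⟧ ^ (tt ts (suc j) ∸ tt ts j ∸ 1)) (range 1 n))
      Λ₁ = ⟦ suc (suc n) ⟧ ^ L (tt ts (suc n))
      Λ₂ = Πℚ (map (λ j → ⟦ j ⟧ ^ (L (tt ts (j ∸ 1)) ∸ L (tt ts j) ℕ.+ 1)) (range 2 (suc n)))

theorem4p4 : (λs : List ℕ) → 1 ≤ length λs → Linked _≥_ λs →
    (q : ℚ) → (q≢0 : q ≢ 0ℚ) → F λs q ≡ RHS λs q q≢0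
theorem4p4 []            ()
theorem4p4 λs@(_ ∷ ls) _ lk q q≢0 = begin
  F λs q
    ≡⟨ F≡Fx1 q λs ⟩
  Fx q 1ℚ λs
    ≡⟨ Fx-expansion λs 1 0 lk (λ i → cong (nth 0 λs) (sym (ℕₚ.m+n∸n≡m i 1))) refl ⟩
  Σℚ (map (path 0 1) (sublists (interval 1 k)))
    ≡⟨ Σpath-from-level-0 1 (length ls) ℕₚ.≤-refl ⟩
  Σℚ (map (Πchain rise 0 1) S)
    ≡⟨ cong Σℚ (Listₚ.map-cong-local (All.map (λ {s} asc → sym (term≡Πchain-rise s asc)) ascending)) ⟩
  Σℚ (map (term λs q q≢0 ∘ (1 ∷_)) S)
    ≡⟨ cong Σℚ (Listₚ.map-∘ S) ⟩
  Σℚ (map (term λs q q≢0) (tSeqs k))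
    ≡⟨ sym (Σℚ-by-length k (term λs q q≢0) (tSeqs k) lengths) ⟩
  RHS λs q q≢0
    ∎
  where
  open ≡-Reasoning
  open Conversion lk q q≢0
  open Chains k
  open Paths q q≢0 k L (lam-antitone lk)
  S = sublists (range 2 k)
  ascending : All (Ascending 1) S
  ascending = sublists-Ascending (range 2 k) (Ascending-interval (length ls) (s≤s (s≤s z≤n)) ℕₚ.≤-refl)
  lengths : All (λ ts → 1 ≤ length ts × length ts ≤ k) (tSeqs k)
  lengths = Allₚ.map⁺ (All.map (λ {s} asc → s≤s z≤n , subst (_≤ k) (ℕₚ.+-comm (length s) 1)
                                                                   (Ascending-length s asc))
                               ascending)
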